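{- Let $A$ be a finite nonempty alphabet, let $S\subset A^*$ be an acyclic set and let $X\subset S$ be a bifix code. Then the coset automaton $\mathcal{B}_X$ of $X$ is reversible and the subgroup of $F_A$ it describes is the subgroup $\langle X\rangle$ generated by $X$. Moreover $X\subset Z$, where $Z$ is the bifix code generating the submonoid recognized by $\mathcal{B}_X$.
   Context: $S$ is factorial if it contains all factors of its elements. For $w\in S$: $L(w)$, $R(w)$ are the sets of letters $a$ with $aw\in S$, resp. $wa\in S$, $E(w)=\{(a,b)\mid awb\in S\}$; $S$ is biextendable if factorial and $E(w)\ne\emptyset$ for all $w$. The extension graph of $w$ is the undirected bipartite graph on the disjoint union of $L(w)$ and $R(w)$ with an edge $a$–$b$ for each $(a,b)\in E(w)$; $S$ is acyclic if biextendable and all extension graphs are acyclic. A bifix code is a set of nonempty words containing no proper prefix and no proper suffix of its elements. Let $P$ be the set of proper prefixes of words of $X$ (including the empty word $1$). The literal automaton of $X^*$ is the deterministic automaton with state set $P$, initial and unique terminal state $1$, and partial transitions $p\cdot a=pa$ if $pa\in P$, $p\cdot a=1$ if $pa\in X$, undefined otherwise. $\theta_X$ is the equivalence on $P$ generated by the pairs $(p,q)$ such that $ps,qs\in X$ for some $s\in A^+$. The coset automaton $\mathcal{B}_X=(R,1,1)$ has as states the set $R$ of $\theta_X$-classes (the class of $1$ is denoted $1$; it is initial and the unique terminal state), with a transition $r\cdot a=s$ whenever there are $p\in r$, $q\in s$ with $p\cdot a=q$ in the literal automaton. A deterministic automaton with initial = unique terminal state $1$ is reversible if for each letter $a$ the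 partial map $p\mapsto p\cdot a$ is injective. A word $w\in A^*$ is recognized if $1\cdot w=1$. A generalized path is a sequence $(p_0,a_1,p_1,\dots,a_m,p_m)$ with $a_i\in A\cup A^{ -1}$ such that $p_{i-1}\cdot a_i=p_i$ if $a_i\in A$ and $p_i\cdot a_i^{ -1}=p_{i-1}$ if $a_i\in A^{ -1}$; its label is the reduced word equivalent to $a_1\cdots a_m$ in the free group $F_A$. The subgroup described by the automaton is the set of labels of generalized paths from $1$ to $1$. -}

module Defs where

open import Data.Nat using (ℕ; zero; suc)
open import Data.Fin using (Fin; zero; suc; inject₁; fromℕ)
open import Data.Fin.Properties using () renaming (_≟_ to _≟ᶠ_)
open import Data.List using (List; []; _∷_; _++_; [_]; map; reverse; concatMap)
open import Data.List.Relation.Unary.All using (All)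
open import Data.Sum using (_⊎_; inj₁; inj₂)
open import Data.Sum.Properties using (≡-dec)
open import Data.Product using (Σ; ∃; ∃-syntax; _×_; _,_; proj₂)
open import Data.Bool using (Bool; true; false)
open import Data.Empty using (⊥)
open import Function.Definitions using (Injective)
open import Relation.Nullary using (¬_; yes; no)
open import Relation.Binary.PropositionalEquality using (_≡_; _≢_)
open import Function.Bundles using (_⇔_)

Letter : ℕ → Set
Letter n = Fin (suc n)

Word : ℕ → Set
Word n = List (Letter n)

Lang : ℕ → Set₁
Lang n = Word n → Set

module _ {n : ℕ} where

  Factorial : Lang n → Set
  Factorial S = ∀ (u v w : Word n) → S (u ++ v ++ w) → S v

  Ext : Lang n → Word n → Letter n → Letter n → Set
  Ext S w a b = S (a ∷ (w ++ [ b ]))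

  Biextendable : Lang n → Set
  Biextendable S = Factorial S × (∀ w → S w → ∃[ a ] ∃[ b ] Ext S w a b)

  -- A cycle in the bipartite extension graph of w: a simple cycle
  -- a₀ - b₀ - a₁ - b₁ - ... - a_{m-1} - b_{m-1} - a₀ with m ≥ 2,
  -- the aᵢ pairwise distinct (left vertices), the bᵢ pairwise
  -- distinct (right vertices), edges (aᵢ,bᵢ) and (aᵢ₊₁,bᵢ) (indices mod m).
  record ExtCycle (S : Lang n) (w : Word n) : Set where
    field
      k     : ℕ
      as    : Fin (suc (suc k)) → Letter n
      bs    : Fin (suc (suc k)) → Letter n
      as-inj : Injective _≡_ _≡_ as
      bs-inj : Injective _≡_ _≡_ bs
      edge₁ : ∀ i → Ext S w (as i) (bs i)
      edge₂ : ∀ (i : Fin (suc k)) → Ext S w (as (suc i)) (bs (inject₁ i))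
      edge₃ : Ext S w (as zero) (bs (fromℕ (suc k)))

  AcyclicGraph : Lang n → Word n → Set
  AcyclicGraph S w = ¬ ExtCycle S w

  Acyclic : Lang n → Set
  Acyclic S = Biextendable S × (∀ w → S w → AcyclicGraph S w)

  BifixCode : Lang n → Set
  BifixCode X =
      (∀ x → X x → x ≢ [])
    × (∀ u s → X u → X (u ++ s) → s ≢ [] → ⊥)
    × (∀ u s → X u → X (s ++ u) → s ≢ [] → ⊥)

  Pref : Lang n → Word n → Set
  Pref X p = (p ≡ []) ⊎ (∃[ c ] ∃[ s ] X (p ++ c ∷ s))

  Lit : Lang n → Word n → Letter n → Word n → Set
  Lit X p a q = Pref X p ×
    ((Pref X (p ++ [ a ]) × q ≡ p ++ [ a ]) ⊎ (X (p ++ [ a ]) × q ≡ []))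

  data Θ (X : Lang n) : Word n → Word n → Set where
    θ-refl  : ∀ {p} → Pref X p → Θ X p p
    θ-gen   : ∀ {p q} c s → X (p ++ c ∷ s) → X (q ++ c ∷ s) → Θ X p q
    θ-sym   : ∀ {p q} → Θ X p q → Θ X q p
    θ-trans : ∀ {p q r} → Θ X p q → Θ X q r → Θ X p r

  -- Coset automaton B_X, with states the θ_X-classes, represented
  -- by their elements. Transition r · a = s iff ∃ p ∈ r, q ∈ s, Lit p a q.

  CosetTrans : Lang n → Word n → Letter n → Word n → Set
  CosetTrans X r a s = ∃[ p ] ∃[ q ] (Θ X r p × Θ X s q × Lit X p a q)

  -- Reversible (deterministic automaton whose letter actions are injective),
  -- stated on classes via representatives.
  CosetReversible : Lang n → Set
  CosetReversible X = ∀ (a : Letter n) (r r' s s' : Word n) →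
    CosetTrans X r a s → CosetTrans X r' a s' →
    (Θ X r r' → Θ X s s') × (Θ X s s' → Θ X r r')

  data CPath (X : Lang n) : Word n → Word n → Word n → Set where
    cp-nil  : ∀ {r s} → Θ X r s → CPath X r [] s
    cp-cons : ∀ {r a t w s} → CosetTrans X r a t → CPath X t w s → CPath X r (a ∷ w) s

  Recognized : Lang n → Word n → Set
  Recognized X w = CPath X [] w []

  MinGen : Lang n → Word n → Set
  MinGen M z = M z × z ≢ [] ×
    ¬ (∃[ u ] ∃[ v ] (M u × M v × u ≢ [] × v ≢ [] × z ≡ u ++ v))

  -- Free group F_A: reduced words over A ⊎ A (inj₂ a stands for a⁻¹)

  GLetter : Set
  GLetter = Letter n ⊎ Letter n

  GWord : Set
  GWord = List GLetter

  inv : GLetter → GLetter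
  inv (inj₁ a) = inj₂ a
  inv (inj₂ a) = inj₁ a

  push : GLetter → GWord → GWord
  push x [] = x ∷ []
  push x (y ∷ w) with ≡-dec _≟ᶠ_ _≟ᶠ_ y (inv x)
  ... | yes _ = w
  ... | no  _ = x ∷ y ∷ w

  reduce : GWord → GWord
  reduce [] = []
  reduce (x ∷ w) = push x (reduce w)

  data GPath (X : Lang n) : Word n → GWord → Word n → Set where
    gp-nil : ∀ {r s} → Θ X r s → GPath X r [] s
    gp-fwd : ∀ {r a t w s} → CosetTrans X r a t → GPath X t w s →
             GPath X r (inj₁ a ∷ w) s
    gp-bwd : ∀ {r a t w s} → CosetTrans X t a r → GPath X t w s →
             GPath X r (inj₂ a ∷ w) s

  Described : Lang n → GWord → Set
  Described X g = ∃[ w ] (GPath X [] w [] × reduce w ≡ g)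

  signed : Bool × Word n → GWord
  signed (true , x)  = map inj₁ x
  signed (false , x) = reverse (map inj₂ x)

  Generated : Lang n → GWord → Set
  Generated X g = ∃[ l ] (All (λ bx → X (proj₂ bx)) l × reduce (concatMap signed l) ≡ g)

-- The θ_X-classes are the connected components, on the side of prefixes, of the incidence graph
-- of X: its vertices are the proper prefixes u and the nonempty suffixes v of words of X, with u
-- joined to v when u v ∈ X.
-- Acyclicity of S extends to generalized extension graphs, whose left and right labels form a suffix
-- code and a prefix code, by induction on the lengths of the labels: a first letter common to all
-- left labels is moved into the middle word, and otherwise the labels are cut down to their first
-- letters. A cycle u₀ v₀ u₁ v₁ ⋯ with uᵢ vᵢ, uᵢ₊₁ vᵢ ∈ S whose uᵢ are pairwise incomparable as
-- suffixes and whose vᵢ are pairwise incomparable as prefixes is such a cycle for the empty word,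
-- hence impossible; by induction on the length, this makes the vertices of every simple path of the
-- incidence graph pairwise incomparable.
-- For a letter a, on a simple path between prefixes p and p′, a suffix vertex beginning with a (for
-- determinism) or a prefix vertex ending with a (for injectivity) splits the path into shorter ones;
-- if there is none, the path closes up through the vertex [ a ] into a forbidden cycle.
-- Since the class of the empty word is a singleton, no word of X is a product of two nonempty
-- recognized words; and the label of a generalized path from r to s equals r x₁^±1 ⋯ xₘ^±1 s⁻¹ in
-- the free group, with x₁, …, xₘ ∈ X.

module Submission where

open import Defs

open import Data.Bool using (Bool; true; false; not)
open import Data.Empty using (⊥; ⊥-elim)
open import Data.Fin using (Fin; zero; suc; inject₁; fromℕ)
open import Data.Fin.Properties using () renaming (_≟_ to _≟ᶠ_)
open import Data.List using (List; []; _∷_; _++_; [_]; map; length; reverse; lookup; take; drop; concatMap; initLast; _∷ʳ′_)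
open import Data.List.Properties
  using (++-assoc; ++-identityʳ; ++-identityˡ-unique; ++-identityʳ-unique; ++-conicalʳ; ∷-injectiveˡ; ∷-injectiveʳ;
         ∷ʳ-injectiveˡ; ∷ʳ-injectiveʳ; map-id; map-++; length-map; length-++-sucʳ; length-++-≤ˡ; length-++-≤ʳ;
         reverse-++; unfold-reverse; reverse-involutive; reverse-injective; reverse-map)
  renaming (≡-dec to ≡-decᴸ)
open import Data.List.Membership.Propositional using (_∈_)
open import Data.List.Membership.Propositional.Properties using (∈-++⁺ˡ; ∈-map⁺; ∈-map⁻; ∈-lookup)
open import Data.List.Relation.Unary.All as All using (All; []; _∷_)
import Data.List.Relation.Unary.All.Properties as All
open import Data.List.Relation.Unary.AllPairs as AllPairs using ([]; _∷_)
open import Data.List.Relation.Unary.Any using (here; there)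
import Data.List.Relation.Unary.First as First
open import Data.List.Relation.Unary.First.Properties using (toView)
open import Data.List.Relation.Unary.Linked as Linked using (Linked; []; [-]; _∷_)
open import Data.List.Relation.Unary.Unique.Propositional using (Unique)
import Data.List.Relation.Binary.Sublist.Propositional as Sublist
open import Data.List.Relation.Binary.Sublist.Propositional
  using ([]; _∷_; _∷ʳ_; ⊆-refl; ⊆-trans) renaming (_⊆_ to _⊑_)
open import Data.List.Relation.Binary.Sublist.Propositional.Properties
  using (length-mono-≤; ++⁺ˡ; ++⁺ʳ; ++⁺; []⊆-universal; All-resp-⊆)
open import Data.List.Relation.Binary.Subset.Propositional using (_⊆_)
open import Data.List.Relation.Binary.Subset.Propositional.Properties using () renaming (map⁺ to ⊆-map⁺)
open import Data.List.Relation.Binary.Permutation.Propositional as ↭ using (_↭_; ↭-sym)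
open import Data.List.Relation.Binary.Permutation.Propositional.Properties
  using (++-comm; ∈-resp-↭; All-resp-↭; ↭-reverse) renaming (map⁺ to ↭-map⁺)
open import Data.Nat using (ℕ; zero; suc; _≤_; z≤n; s≤s)
open import Data.Nat.ListAction using (sum)
open import Data.Nat.ListAction.Properties using (sum-↭)
open import Data.Nat.Properties
  using (≤-refl; ≤-trans; ≤-pred; ≤-reflexive; +-monoʳ-≤; +-mono-≤; n≤1+n; m≤n+m; module ≤-Reasoning)
open import Data.Product as Product using (∃-syntax; _×_; _,_; proj₁; proj₂)
open import Data.Sum using (_⊎_; inj₁; inj₂; swap)
open import Data.Sum.Properties using (inj₁-injective; inj₂-injective) renaming (≡-dec to ≡-dec⊎)
open import Data.Unit using (⊤; tt)
open import Function using (_∘_; id; flip)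
open import Function.Bundles using (_⇔_; mk⇔)
open import Relation.Binary.Definitions using (DecidableEquality)
open import Relation.Binary.PropositionalEquality
  using (_≡_; _≢_; refl; sym; trans; cong; cong₂; subst; subst₂; ≢-sym; module ≡-Reasoning)
open import Relation.Nullary using (¬_; Dec; yes; no)
open import Relation.Nullary.Decidable using (toSum)

private variable
  A B : Set

lastOf : A → List A → A
lastOf x [] = x
lastOf x (y ∷ ys) = lastOf y ys

lastOf-++ : (x : A) (xs : List A) (y : A) (ys : List A) → lastOf x (xs ++ y ∷ ys) ≡ lastOf y ys
lastOf-++ x [] y ys = refl
lastOf-++ x (z ∷ xs) y ys = lastOf-++ z xs y ys

lastOf-∈ : (x : A) (xs : List A) → lastOf x xs ∈ x ∷ xs
lastOf-∈ x [] = here refl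
lastOf-∈ x (y ∷ ys) = there (lastOf-∈ y ys)

lastOf-map : (f : A → B) (x : A) (xs : List A) → lastOf (f x) (map f xs) ≡ f (lastOf x xs)
lastOf-map f x [] = refl
lastOf-map f x (y ∷ ys) = lastOf-map f y ys

length-∷ʳ : (xs : List A) (z : A) → length (xs ++ [ z ]) ≡ suc (length xs)
length-∷ʳ [] z = refl
length-∷ʳ (x ∷ xs) z = cong suc (length-∷ʳ xs z)

∷ʳ-nonempty : (xs : List A) (z : A) → xs ++ [ z ] ≢ []
∷ʳ-nonempty [] z ()
∷ʳ-nonempty (_ ∷ _) z ()

module _ {R : A → A → Set} where

  Linked-split : ∀ x xs y ys → Linked R (x ∷ xs ++ y ∷ ys) →
                 Linked R (x ∷ xs) × R (lastOf x xs) y × Linked R (y ∷ ys)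
  Linked-split x [] y ys (r ∷ l) = [-] , r , l
  Linked-split x (z ∷ xs) y ys (r ∷ l) with Linked-split z xs y ys l
  ... | l₁ , r′ , l₂ = r ∷ l₁ , r′ , l₂

  Linked-join : ∀ x xs y ys → Linked R (x ∷ xs) → R (lastOf x xs) y → Linked R (y ∷ ys) →
                Linked R (x ∷ xs ++ y ∷ ys)
  Linked-join x [] y ys l r l′ = r ∷ l′
  Linked-join x (z ∷ xs) y ys (r₀ ∷ l) r l′ = r₀ ∷ Linked-join z xs y ys l r l′

  Linked-++⁻ˡ : ∀ x xs {ys} → Linked R (x ∷ xs ++ ys) → Linked R (x ∷ xs)
  Linked-++⁻ˡ x [] l = [-]
  Linked-++⁻ˡ x (y ∷ xs) (r ∷ l) = r ∷ Linked-++⁻ˡ y xs l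

  Linked-++⁻ʳ : ∀ xs {ys} → Linked R (xs ++ ys) → Linked R ys
  Linked-++⁻ʳ [] l = l
  Linked-++⁻ʳ (x ∷ xs) l = Linked-++⁻ʳ xs (Linked.tail l)

unique⊎duplicate : (f : A → B) → DecidableEquality B → (xs : List A) →
  Unique (map f xs) ⊎
  ∃[ as ] ∃[ p ] ∃[ bs ] ∃[ q ] ∃[ cs ] (xs ≡ as ++ p ∷ bs ++ q ∷ cs × f p ≡ f q)
unique⊎duplicate f _≟_ [] = inj₁ []
unique⊎duplicate f _≟_ (x ∷ xs) with First.first (λ y → swap (toSum (f x ≟ f y))) xs
... | inj₁ fst with toView fst
...   | First._++_∷_ {bs} {q} _ e cs = inj₂ ([] , x , bs , q , cs , refl , e)
unique⊎duplicate f _≟_ (x ∷ xs) | inj₂ distinct with unique⊎duplicate f _≟_ xs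
... | inj₁ u = inj₁ (All.map⁺ distinct ∷ u)
... | inj₂ (as , p , bs , q , cs , e , fe) = inj₂ (x ∷ as , p , bs , q , cs , cong (x ∷_) e , fe)

Unique-map-lookup : (f : A → B) (xs : List A) → Unique (map f xs) →
                    ∀ i j → f (lookup xs i) ≡ f (lookup xs j) → i ≡ j
Unique-map-lookup f (x ∷ xs) u zero zero e = refl
Unique-map-lookup f (x ∷ xs) (distinct ∷ u) zero (suc j) e = ⊥-elim (All.lookup distinct (∈-map⁺ f (∈-lookup j)) e)
Unique-map-lookup f (x ∷ xs) (distinct ∷ u) (suc i) zero e = ⊥-elim (All.lookup distinct (∈-map⁺ f (∈-lookup i)) (sym e))
Unique-map-lookup f (x ∷ xs) (_ ∷ u) (suc i) (suc j) e = cong suc (Unique-map-lookup f xs u i j e)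

Linked-lookup : ∀ {R : A → A → Set} x xs → Linked R (x ∷ xs) →
                ∀ (i : Fin (length xs)) → R (lookup (x ∷ xs) (inject₁ i)) (lookup (x ∷ xs) (suc i))
Linked-lookup x (y ∷ ys) (r ∷ l) zero = r
Linked-lookup x (y ∷ ys) (r ∷ l) (suc i) = Linked-lookup y ys l i

lookup-last : (x : A) (xs : List A) → lookup (x ∷ xs) (fromℕ (length xs)) ≡ lastOf x xs
lookup-last x [] = refl
lookup-last x (y ∷ ys) = lookup-last y ys

Unique-⊑ : ∀ {xs ys : List A} → xs ⊑ ys → Unique ys → Unique xs
Unique-⊑ [] [] = []
Unique-⊑ (_ ∷ʳ sub) (_ ∷ unique) = Unique-⊑ sub unique
Unique-⊑ (refl ∷ sub) (distinct ∷ unique) = All-resp-⊆ sub distinct ∷ Unique-⊑ sub unique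

Unique-resp-↭ : ∀ {xs ys : List A} → Unique xs → xs ↭ ys → Unique ys
Unique-resp-↭ unique ↭.refl = unique
Unique-resp-↭ (distinct ∷ unique) (↭.prep x p) = All-resp-↭ p distinct ∷ Unique-resp-↭ unique p
Unique-resp-↭ ((x≢y ∷ x∉) ∷ y∉ ∷ unique) (↭.swap x y p) =
  (≢-sym x≢y ∷ All-resp-↭ p y∉) ∷ All-resp-↭ p x∉ ∷ Unique-resp-↭ unique p
Unique-resp-↭ unique (↭.trans p q) = Unique-resp-↭ (Unique-resp-↭ unique p) q

-- Closed walks in bipartite graphs

-- A closed walk a₀ b₀ a₁ b₁ ⋯ aₘ bₘ a₀ in a bipartite graph is stored as its list of edges
-- (aᵢ , bᵢ); a step from (aᵢ , bᵢ) to (aᵢ₊₁ , bᵢ₊₁) uses the edge aᵢ₊₁ – bᵢ and never backtracks.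
module _ {L R : Set} (E : L → R → Set) where

  Edge : L × R → Set
  Edge (u , v) = E u v

  Step : L × R → L × R → Set
  Step (u , v) (u′ , v′) = E u′ v × u ≢ u′ × v ≢ v′

  Walk : L × R → List (L × R) → Set
  Walk x xs = All Edge (x ∷ xs) × Linked Step (x ∷ xs)

  ClosedWalk : L × R → List (L × R) → Set
  ClosedWalk x xs = Walk x xs × Step (lastOf x xs) x

  ClosableˡWalk ClosableʳWalk : L × R → List (L × R) → Set
  ClosableˡWalk x xs = Walk x xs × E (proj₁ x) (proj₂ (lastOf x xs)) × proj₁ (lastOf x xs) ≢ proj₁ x
  ClosableʳWalk x xs = Walk x xs × E (proj₁ x) (proj₂ (lastOf x xs)) × proj₂ (lastOf x xs) ≢ proj₂ x

  ClosedSubwalk : L × R → List (L × R) → Set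
  ClosedSubwalk x xs = ∃[ y ] ∃[ ys ] (y ∷ ys ⊑ x ∷ xs × ClosedWalk y ys)

  SimpleClosedSubwalk : L × R → List (L × R) → Set
  SimpleClosedSubwalk x xs = ∃[ y ] ∃[ ys ]
    (y ∷ ys ⊑ x ∷ xs × ClosedWalk y ys × Unique (map proj₁ (y ∷ ys)) × Unique (map proj₂ (y ∷ ys)))

  ClosedWalk-has-two-edges : ∀ {x xs} → ClosedWalk x xs →
                             ∃[ y ] ∃[ ys ] (xs ≡ y ∷ ys × proj₁ x ≢ proj₁ y)
  ClosedWalk-has-two-edges {x} {[]} (_ , _ , ne , _) = ⊥-elim (ne refl)
  ClosedWalk-has-two-edges {x} {y ∷ ys} ((_ , (_ , ne , _) ∷ _) , _) = y , ys , refl , ne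

  ClosedWalk-rotate : ∀ x as y bs → ClosedWalk x (as ++ y ∷ bs) → ClosedWalk y (bs ++ x ∷ as)
  ClosedWalk-rotate x as y bs ((edges , steps) , closing) with Linked-split x as y bs steps
  ... | steps₁ , middle , steps₂ =
    ( All.++⁺ (All.++⁻ʳ (x ∷ as) edges) (All.++⁻ˡ (x ∷ as) edges)
    , Linked-join y bs x as steps₂ (subst (λ z → Step z x) (lastOf-++ x as y bs) closing) steps₁ )
    , subst (λ z → Step z y) (sym (lastOf-++ y bs x as)) middle

  module _ (_≟ˡ_ : DecidableEquality L) (_≟ʳ_ : DecidableEquality R) where

    -- Both lemmas drop the endpoint at which the closing step would backtrack; the fuel n bounds the length.
    closeˡ : ∀ n x xs → length xs ≤ n → ClosableˡWalk x xs → ClosedSubwalk x xs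
    closeʳ : ∀ n x xs → length xs ≤ n → ClosableʳWalk x xs → ClosedSubwalk x xs

    closeˡ n x [] _ (_ , _ , ne) = ⊥-elim (ne refl)
    closeˡ (suc n) x (y ∷ ys) (s≤s bound) ((edges , steps) , closing , ne)
      with proj₂ (lastOf y ys) ≟ʳ proj₂ x
    ... | no ne′ = x , y ∷ ys , ⊆-refl , (edges , steps) , closing , ne , ne′
    ... | yes same with steps
    ...   | (step , _ , ne′) ∷ steps′
            with closeʳ n y ys bound
                   ( (All.tail edges , steps′)
                   , subst (E (proj₁ y)) (sym same) step
                   , λ e → ne′ (trans (sym same) e) )
    ...     | z , zs , sub , cyc = z , zs , x ∷ʳ sub , cyc

    closeʳ zero x [] _ (_ , _ , ne) = ⊥-elim (ne refl)
    closeʳ (suc n) x xs bound closable with initLast xs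
    closeʳ (suc n) x .[] bound (_ , _ , ne) | [] = ⊥-elim (ne refl)
    closeʳ (suc n) x .(ws ++ [ z ]) bound ((edges , steps) , closing , ne) | ws ∷ʳ′ z
      with proj₁ z ≟ˡ proj₁ x
    ... | no ne′ = x , ws ++ [ z ] , ⊆-refl , (edges , steps) , closing ,
                   (λ e → ne′ (trans (sym (cong proj₁ (lastOf-++ x ws z []))) e)) , ne
    ... | yes same with Linked-split x ws z [] steps
    ...   | steps′ , (step , ne″ , _) , _
            with closeˡ n x ws shorter
                   ( (All.++⁻ˡ (x ∷ ws) edges , steps′)
                   , subst (λ t → E t (proj₂ (lastOf x ws))) same step
                   , λ e → ne″ (trans e (sym same)) )
      where
      shorter : length ws ≤ n
      shorter = ≤-pred (subst (_≤ suc n) (length-∷ʳ ws z) bound)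
    ...     | t , ts , sub , cyc = t , ts , ⊆-trans sub (++⁺ʳ [ z ] ⊆-refl) , cyc

    private
      inner-shorter : ∀ {x : L × R} {xs} as p bs q cs → x ∷ xs ≡ as ++ p ∷ bs ++ q ∷ cs →
                      suc (length bs) ≤ length xs
      inner-shorter {xs = xs} as p bs q cs e = ≤-pred (begin
        suc (suc (length bs))            ≤⟨ s≤s (s≤s (length-++-≤ˡ bs)) ⟩
        suc (suc (length (bs ++ cs)))    ≡⟨ cong suc (sym (length-++-sucʳ bs q cs)) ⟩
        length (p ∷ bs ++ q ∷ cs)        ≤⟨ length-++-≤ʳ (p ∷ bs ++ q ∷ cs) {as} ⟩
        length (as ++ p ∷ bs ++ q ∷ cs)  ≡⟨ cong length (sym e) ⟩
        suc (length xs)                  ∎)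
        where open ≤-Reasoning

      segment : ∀ {x xs} as p bs q cs → x ∷ xs ≡ as ++ p ∷ bs ++ q ∷ cs → Walk x xs →
                Walk p bs × Step (lastOf p bs) q × Edge q
      segment as p bs q cs e (edges , steps) with
        Linked-split p bs q cs (Linked-++⁻ʳ as (subst (Linked Step) e steps))
      ... | steps′ , step , _ = (All.++⁻ˡ (p ∷ bs) edges′ , steps′) , step , All.head (All.++⁻ʳ (p ∷ bs) edges′)
        where
        edges′ : All Edge (p ∷ bs ++ q ∷ cs)
        edges′ = All.++⁻ʳ as (subst (All Edge) e edges)

      repeated-left : ∀ {x xs} as p bs q cs → x ∷ xs ≡ as ++ p ∷ bs ++ q ∷ cs → Walk x xs →
                      proj₁ p ≡ proj₁ q → ClosableˡWalk p bs
      repeated-left as p bs q cs e walk same with segment as p bs q cs e walk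
      ... | walk′ , (step , ne , _) , _ =
        walk′ , subst (λ t → E t (proj₂ (lastOf p bs))) (sym same) step , λ e′ → ne (trans e′ same)

      repeated-right : ∀ {x xs} as p b bs q cs → x ∷ xs ≡ as ++ p ∷ b ∷ bs ++ q ∷ cs → Walk x xs →
                       proj₂ p ≡ proj₂ q → ClosableʳWalk b (bs ++ [ q ])
      repeated-right as p b bs q cs e walk same with segment as p (b ∷ bs) q cs e walk
      ... | (_ ∷ edges , (first , _ , ne) ∷ steps) , step , edge =
          ( (All.++⁺ edges (edge ∷ []) , Linked-join b bs q [] steps step [-])
          , subst (λ t → E (proj₁ b) (proj₂ t)) (sym (lastOf-++ b bs q [])) (subst (E (proj₁ b)) same first)
          , λ e′ → ne (trans same (trans (sym (cong proj₂ (lastOf-++ b bs q []))) e′)) )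

      repeated-adjacent : ∀ {x xs} as p q cs → x ∷ xs ≡ as ++ p ∷ q ∷ cs → Walk x xs →
                          proj₂ p ≢ proj₂ q
      repeated-adjacent as p q cs e walk with segment as p [] q cs e walk
      ... | _ , (_ , _ , ne) , _ = ne

    simplify : ∀ n x xs → length xs ≤ n → ClosedWalk x xs → SimpleClosedSubwalk x xs
    simplify zero x [] _ cyc with ClosedWalk-has-two-edges cyc
    ... | _ , _ , () , _
    simplify (suc n) x xs bound cyc@(walk , _) with unique⊎duplicate proj₁ _≟ˡ_ (x ∷ xs)
    ... | inj₂ (as , p , bs , q , cs , e , same)
      with closeˡ (length bs) p bs ≤-refl (repeated-left as p bs q cs e walk same)
    ...   | y , ys , sub , cyc′ with simplify n y ys shorter cyc′
      where
      shorter : length ys ≤ n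
      shorter = ≤-trans (≤-pred (length-mono-≤ sub)) (≤-pred (≤-trans (inner-shorter as p bs q cs e) bound))
    ...     | z , zs , sub′ , simple = z , zs , ⊆-trans sub′ (⊆-trans sub (subst (p ∷ bs ⊑_) (sym e) inner)) , simple
      where
      inner : p ∷ bs ⊑ as ++ p ∷ bs ++ q ∷ cs
      inner = ++⁺ˡ as (refl ∷ ++⁺ʳ (q ∷ cs) ⊆-refl)
    simplify (suc n) x xs bound cyc@(walk , _) | inj₁ uniqueˡ with unique⊎duplicate proj₂ _≟ʳ_ (x ∷ xs)
    ... | inj₁ uniqueʳ = x , xs , ⊆-refl , cyc , uniqueˡ , uniqueʳ
    ... | inj₂ (as , p , [] , q , cs , e , same) = ⊥-elim (repeated-adjacent as p q cs e walk same)
    ... | inj₂ (as , p , b ∷ bs , q , cs , e , same)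
      with closeʳ (length (bs ++ [ q ])) b (bs ++ [ q ]) ≤-refl (repeated-right as p b bs q cs e walk same)
    ...   | y , ys , sub , cyc′ with simplify n y ys shorter cyc′
      where
      shorter : length ys ≤ n
      shorter = ≤-trans (≤-pred (length-mono-≤ sub))
                  (subst (_≤ n) (sym (length-∷ʳ bs q)) (≤-pred (≤-trans (inner-shorter as p (b ∷ bs) q cs e) bound)))
    ...     | z , zs , sub′ , simple = z , zs , ⊆-trans sub′ (⊆-trans sub (subst (b ∷ bs ++ [ q ] ⊑_) (sym e) inner)) , simple
      where
      inner : b ∷ bs ++ [ q ] ⊑ as ++ p ∷ b ∷ bs ++ q ∷ cs
      inner = ++⁺ˡ as (p ∷ʳ refl ∷ ++⁺ ⊆-refl (refl ∷ []⊆-universal cs))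

module _ {L R L′ R′ : Set} {E : L → R → Set} {E′ : L′ → R′ → Set}
         (f : L → L′) (g : R → R′) (P : L → Set) (Q : R → Set)
         (edge⁺ : ∀ {u v} → P u → Q v → E u v → E′ (f u) (g v))
         (f-injective : ∀ {u u′} → P u → P u′ → u ≢ u′ → f u ≢ f u′)
         (g-injective : ∀ {v v′} → Q v → Q v′ → v ≢ v′ → g v ≢ g v′) where

  InDomain : L × R → Set
  InDomain (u , v) = P u × Q v

  private
    step⁺ : ∀ {p q} → InDomain p → InDomain q → Step E p q → Step E′ (Product.map f g p) (Product.map f g q)
    step⁺ (Pu , Qv) (Pu′ , Qv′) (e , ne₁ , ne₂) = edge⁺ Pu′ Qv e , f-injective Pu Pu′ ne₁ , g-injective Qv Qv′ ne₂

    edges⁺ : ∀ {ps} → All InDomain ps → All (Edge E) ps → All (Edge E′) (map (Product.map f g) ps)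
    edges⁺ [] [] = []
    edges⁺ ((Pu , Qv) ∷ dom) (e ∷ edges) = edge⁺ Pu Qv e ∷ edges⁺ dom edges

    steps⁺ : ∀ {p ps} → All InDomain (p ∷ ps) → Linked (Step E) (p ∷ ps) →
             Linked (Step E′) (map (Product.map f g) (p ∷ ps))
    steps⁺ {ps = []} _ _ = [-]
    steps⁺ {ps = _ ∷ _} (gp ∷ gq ∷ dom) (s ∷ steps) = step⁺ gp gq s ∷ steps⁺ (gq ∷ dom) steps

  ClosedWalk-map : ∀ x xs → All InDomain (x ∷ xs) → ClosedWalk E x xs →
                   ClosedWalk E′ (Product.map f g x) (map (Product.map f g) xs)
  ClosedWalk-map x xs dom ((edges , steps) , closing) =
    (edges⁺ dom edges , steps⁺ dom steps) ,
    subst (λ t → Step E′ t (Product.map f g x)) (sym (lastOf-map (Product.map f g) x xs))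
      (step⁺ (All.lookup dom (lastOf-∈ x xs)) (All.head dom) closing)

module _ {L R : Set} (E : L → R → Set) where

  private
    -- The walk a₀ b₀ a₁ ⋯ aₘ bₘ a₀ read from b₀: its edges are (bᵢ , aᵢ₊₁), closing with (bₘ , a₀).
    transpose : L → List (L × R) → List (R × L)
    transpose a₀ [] = []
    transpose a₀ ((_ , v) ∷ []) = (v , a₀) ∷ []
    transpose a₀ ((_ , v) ∷ q ∷ ps) = (v , proj₁ q) ∷ transpose a₀ (q ∷ ps)

    transpose-walk : ∀ a₀ p ps → Walk E p ps → E a₀ (proj₂ (lastOf p ps)) → proj₁ (lastOf p ps) ≢ a₀ →
      ∃[ y ] ∃[ ys ] (transpose a₀ (p ∷ ps) ≡ y ∷ ys × proj₁ y ≡ proj₂ p × proj₁ p ≢ proj₂ y ×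
                      Walk (flip E) y ys × lastOf y ys ≡ (proj₂ (lastOf p ps) , a₀))
    transpose-walk a₀ p [] _ e ne = (proj₂ p , a₀) , [] , refl , refl , ne , (e ∷ [] , [-]) , refl
    transpose-walk a₀ p (q ∷ ps) (_ ∷ edges , (e , ne₁ , ne₂) ∷ steps) e₀ ne
      with transpose-walk a₀ q ps (edges , steps) e₀ ne
    ... | y , ys , eq , fst , ne′ , (edges′ , steps′) , last =
      (proj₂ p , proj₁ q) , y ∷ ys , cong (_ ∷_) eq , refl , ne₁ ,
      ( e ∷ edges′
      , (subst (E (proj₁ q)) (sym fst) (All.head edges) , (λ e′ → ne₂ (trans e′ fst)) , ne′) ∷ steps′ ) ,
      last

    lefts-transpose : ∀ a₀ ps → map proj₁ (transpose a₀ ps) ⊆ map proj₂ ps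
    lefts-transpose a₀ [] ()
    lefts-transpose a₀ (p ∷ []) i = i
    lefts-transpose a₀ (p ∷ q ∷ ps) (here e) = here e
    lefts-transpose a₀ (p ∷ q ∷ ps) (there i) = there (lefts-transpose a₀ (q ∷ ps) i)

    rights-transpose : ∀ a₀ ps → map proj₂ (transpose a₀ ps) ⊆ a₀ ∷ map proj₁ ps
    rights-transpose a₀ [] ()
    rights-transpose a₀ (p ∷ []) (here e) = here e
    rights-transpose a₀ (p ∷ q ∷ ps) (here e) = there (there (here e))
    rights-transpose a₀ (p ∷ q ∷ ps) (there i) with rights-transpose a₀ (q ∷ ps) i
    ... | here e = here e
    ... | there j = there (there j)

  ClosedWalk-transpose : ∀ x xs → ClosedWalk E x xs →
    ∃[ y ] ∃[ ys ] (ClosedWalk (flip E) y ys × map proj₁ (y ∷ ys) ⊆ map proj₂ (x ∷ xs)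
                                      × map proj₂ (y ∷ ys) ⊆ map proj₁ (x ∷ xs))
  ClosedWalk-transpose x xs (walk , (e , ne₁ , ne₂))
    with transpose-walk (proj₁ x) x xs walk e ne₁
  ... | y , ys , eq , fst , ne′ , walk′ , last =
    y , ys ,
    ( walk′
    , subst (λ t → Step (flip E) t y) (sym last)
        (subst (E (proj₁ x)) (sym fst) (All.head (proj₁ walk)) , (λ e′ → ne₂ (trans e′ fst)) , ne′) ) ,
    subst (λ t → map proj₁ t ⊆ map proj₂ (x ∷ xs)) eq (lefts-transpose (proj₁ x) (x ∷ xs)) ,
    subst (λ t → map proj₂ t ⊆ map proj₁ (x ∷ xs)) eq (absorb ∘ rights-transpose (proj₁ x) (x ∷ xs))
    where
    absorb : ∀ {z} → z ∈ proj₁ x ∷ map proj₁ (x ∷ xs) → z ∈ map proj₁ (x ∷ xs)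
    absorb (here e) = here e
    absorb (there i) = i

-- Paths in graphs

module _ {V : Set} (R : V → V → Set) where

  Path : V → V → Set
  Path a b = ∃[ l ] (Linked R (a ∷ l) × lastOf a l ≡ b)

  SimplePath : V → V → Set
  SimplePath a b = ∃[ l ] (Linked R (a ∷ l) × lastOf a l ≡ b × Unique (a ∷ l))

  Path-refl : ∀ a → Path a a
  Path-refl a = [] , [-] , refl

  Path-trans : ∀ {a b c} → Path a b → Path b c → Path a c
  Path-trans {a} (l , steps , refl) ([] , _ , refl) =
    l ++ [] , subst (λ t → Linked R (a ∷ t)) (sym (++-identityʳ l)) steps , cong (lastOf a) (++-identityʳ l)
  Path-trans {a} (l , steps , refl) (y ∷ ys , r ∷ steps′ , refl) =
    l ++ y ∷ ys , Linked-join a l y ys steps r steps′ , lastOf-++ a l y ys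

  Path-sym : (∀ {a b} → R a b → R b a) → ∀ {a b} → Path a b → Path b a
  Path-sym R-sym {a} ([] , _ , refl) = Path-refl a
  Path-sym R-sym {a} (y ∷ ys , r ∷ steps , refl) =
    Path-trans (Path-sym R-sym (ys , steps , refl)) ([ a ] , R-sym r ∷ [-] , refl)

  module _ (_≟_ : DecidableEquality V) where

    -- Cutting out the closed subwalk between two visits of the same vertex.
    shorten : ∀ n a l → length l ≤ n → Linked R (a ∷ l) → SimplePath a (lastOf a l)
    shorten zero a [] _ steps = [] , steps , refl , [] ∷ []
    shorten (suc n) a l bound steps with unique⊎duplicate (λ z → z) _≟_ (a ∷ l)
    ... | inj₁ unique = l , steps , refl , subst Unique (map-id (a ∷ l)) unique
    ... | inj₂ ([] , p , bs , .p , cs , refl , refl)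
      with shorten n p cs (≤-pred (≤-trans (length-++-≤ʳ (p ∷ cs) {bs}) bound)) (Linked-++⁻ʳ (p ∷ bs) steps)
    ...   | l′ , steps′ , last , unique = l′ , steps′ , trans last (sym (lastOf-++ p bs p cs)) , unique
    shorten (suc n) a l bound steps | inj₂ (.a ∷ as , p , bs , .p , cs , refl , refl)
      with Linked-split a as p (bs ++ p ∷ cs) steps
    ... | steps₁ , r , steps₂
      with shorten n a (as ++ p ∷ cs) shorter (Linked-join a as p cs steps₁ r (Linked-++⁻ʳ (p ∷ bs) steps₂))
      where
      shorter : length (as ++ p ∷ cs) ≤ n
      shorter = ≤-pred (≤-trans (≤-reflexive (sym (length-++-sucʳ as p (p ∷ cs))))
                                (≤-trans (length-mono-≤ (++⁺ (⊆-refl {x = as}) (refl ∷ ++⁺ˡ bs (⊆-refl {x = p ∷ cs}))))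
                                         bound))
    ...   | l′ , steps′ , last , unique =
      l′ , steps′ ,
      trans last (trans (lastOf-++ a as p cs) (sym (trans (lastOf-++ a as p (bs ++ p ∷ cs)) (lastOf-++ p bs p cs)))) ,
      unique

-- Generalized extension graphs

module _ {A : Set} where

  PrefixFree : List (List A) → Set
  PrefixFree us = ∀ {u v} → u ∈ us → v ∈ us → ∀ w → v ≡ u ++ w → w ≡ []

  Singleton : List A → Set
  Singleton u = ∃[ c ] (u ≡ [ c ])

  Singletons : List (List A) → Set
  Singletons = All Singleton

  PrefixFree-⊆ : ∀ {us vs} → vs ⊆ us → PrefixFree us → PrefixFree vs
  PrefixFree-⊆ sub pf i j = pf (sub i) (sub j)

  Singletons-⊆ : ∀ {us vs} → vs ⊆ us → Singletons us → Singletons vs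
  Singletons-⊆ sub s = All.tabulate (All.lookup s ∘ sub)

  StartsWith : A → List A → Set
  StartsWith c [] = ⊥
  StartsWith c (d ∷ _) = c ≡ d

  SameHead : List A → List A → Set
  SameHead (a ∷ _) (b ∷ _) = a ≡ b
  SameHead _ _ = ⊥

  sameHead-refl : ∀ {u} → u ≢ [] → SameHead u u
  sameHead-refl {[]} ne = ⊥-elim (ne refl)
  sameHead-refl {a ∷ _} _ = refl

  sameHead-trans : ∀ {u v w} → SameHead u v → SameHead v w → SameHead u w
  sameHead-trans {_ ∷ _} {_ ∷ _} {_ ∷ _} refl refl = refl

  sameHead⇒take≡ : ∀ {u v} → SameHead u v → take 1 u ≡ take 1 v
  sameHead⇒take≡ {_ ∷ _} {_ ∷ _} refl = refl

  ¬sameHead⇒take≢ : ∀ {u v} → u ≢ [] → v ≢ [] → ¬ SameHead u v → take 1 u ≢ take 1 v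
  ¬sameHead⇒take≢ {[]} ne _ _ = ⊥-elim (ne refl)
  ¬sameHead⇒take≢ {_ ∷ _} {[]} _ ne _ = ⊥-elim (ne refl)
  ¬sameHead⇒take≢ {_ ∷ _} {_ ∷ _} _ _ diff refl = diff refl

  startsWith-sameHead : ∀ {c u v} → StartsWith c u → SameHead u v → StartsWith c v
  startsWith-sameHead {u = _ ∷ _} {v = _ ∷ _} refl refl = refl

  nonempty-head : ∀ {u} → u ≢ [] → ∃[ c ] StartsWith c u
  nonempty-head {[]} ne = ⊥-elim (ne refl)
  nonempty-head {a ∷ _} _ = a , refl

  take1-singleton : ∀ {u : List A} → u ≢ [] → Singleton (take 1 u)
  take1-singleton {[]} ne = ⊥-elim (ne refl)
  take1-singleton {a ∷ _} _ = a , refl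

  PrefixFree-drop1 : ∀ {c us} → All (StartsWith c) us → PrefixFree us → PrefixFree (map (drop 1) us)
  PrefixFree-drop1 {c} {us} starts pf i j w e with ∈-map⁻ (drop 1) i | ∈-map⁻ (drop 1) j
  ... | u , iu , refl | v , iv , refl = pf iu iv w (extend (All.lookup starts iu) (All.lookup starts iv) e)
    where
    extend : ∀ {u v} → StartsWith c u → StartsWith c v → drop 1 v ≡ drop 1 u ++ w → v ≡ u ++ w
    extend {_ ∷ _} {_ ∷ _} refl refl e′ = cong (c ∷_) e′

  NonemptyLeft : List A × List A → Set
  NonemptyLeft (u , _) = u ≢ []

  SameLeftHead : List A × List A → List A × List A → Set
  SameLeftHead (u , _) (v , _) = SameHead u v

  leftLength : List (List A × List A) → ℕ
  leftLength ps = sum (map (length ∘ proj₁) ps)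

  strip collapse : List A × List A → List A × List A
  strip = Product.map₁ (drop 1)
  collapse = Product.map₁ (take 1)

  lefts-strip : ∀ ps → map (drop 1) (map proj₁ ps) ≡ map proj₁ (map strip ps)
  lefts-strip [] = refl
  lefts-strip (p ∷ ps) = cong (_ ∷_) (lefts-strip ps)

  rights-strip : ∀ ps → map proj₂ ps ≡ map proj₂ (map strip ps)
  rights-strip [] = refl
  rights-strip (p ∷ ps) = cong (_ ∷_) (rights-strip ps)

  leftLength-strip : ∀ ps → leftLength (map strip ps) ≤ leftLength ps
  leftLength-strip [] = z≤n
  leftLength-strip (([] , _) ∷ ps) = leftLength-strip ps
  leftLength-strip ((_ ∷ u , _) ∷ ps) = +-mono-≤ (n≤1+n (length u)) (leftLength-strip ps)

  leftLength-rotate : ∀ x as y bs → leftLength (y ∷ bs ++ x ∷ as) ≡ leftLength (x ∷ as ++ y ∷ bs)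
  leftLength-rotate x as y bs = sum-↭ (↭-map⁺ (length ∘ proj₁) (++-comm (y ∷ bs) (x ∷ as)))

  leftLength-⊑ : ∀ {ps qs} → ps ⊑ qs → leftLength ps ≤ leftLength qs
  leftLength-⊑ Sublist.[] = z≤n
  leftLength-⊑ (q ∷ʳ sub) = ≤-trans (leftLength-⊑ sub) (m≤n+m _ (length (proj₁ q)))
  leftLength-⊑ (refl ∷ sub) = +-monoʳ-≤ _ (leftLength-⊑ sub)

  rotate-⊆ : ∀ (x : List A × List A) as y bs → y ∷ bs ++ x ∷ as ⊆ x ∷ as ++ y ∷ bs
  rotate-⊆ x as y bs = ∈-resp-↭ (++-comm (y ∷ bs) (x ∷ as))

  module _ {E : List A → List A → Set} where

    nonempty-lefts : ∀ {x xs} → ClosedWalk E x xs → PrefixFree (map proj₁ (x ∷ xs)) → All NonemptyLeft (x ∷ xs)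
    nonempty-lefts {x} {xs} cyc pf with ClosedWalk-has-two-edges E cyc
    ... | y , ys , refl , distinct = All.tabulate λ {p} ip e →
          distinct (trans (empty ip (here refl) e) (sym (empty ip (there (here refl)) e)))
      where
      empty : ∀ {p z} → p ∈ x ∷ y ∷ ys → z ∈ x ∷ y ∷ ys → proj₁ p ≡ [] → proj₁ z ≡ []
      empty {p} {z} ip iz e = pf (∈-map⁺ proj₁ ip) (∈-map⁺ proj₁ iz) (proj₁ z) (cong (_++ proj₁ z) (sym e))

module LeftReduction {A : Set} (_≟_ : DecidableEquality A)
  (I : Set) (E : I → List A → List A → Set) (push : A → I → I)
  (push-edge : ∀ i c u v → E i (c ∷ u) v → E (push c i) u v)
  (head-edge : ∀ i c u v → E i (c ∷ u) v → E i [ c ] v)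
  (Q : List (List A) → Set) (Q-⊆ : ∀ {us vs} → vs ⊆ us → Q us → Q vs)
  (base : ∀ i x xs → ClosedWalk (E i) x xs → Singletons (map proj₁ (x ∷ xs)) → Q (map proj₂ (x ∷ xs)) → ⊥)
  where

  private
    _≟ʷ_ : DecidableEquality (List A)
    _≟ʷ_ = ≡-decᴸ _≟_

    startsWith? : ∀ c w → Dec (StartsWith c w)
    startsWith? c [] = no λ ()
    startsWith? c (d ∷ _) = c ≟ d

    sameHead? : ∀ u v → Dec (SameHead u v)
    sameHead? [] _ = no λ ()
    sameHead? (a ∷ _) [] = no λ ()
    sameHead? (a ∷ _) (b ∷ _) = a ≟ b

  NoClosedWalkBelow : ℕ → Set
  NoClosedWalkBelow m = ∀ i x xs → leftLength (x ∷ xs) ≤ m → ClosedWalk (E i) x xs →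
                        PrefixFree (map proj₁ (x ∷ xs)) → Q (map proj₂ (x ∷ xs)) → ⊥

  collapse-edge : ∀ {i u v} → u ≢ [] → E i u v → E i (take 1 u) v
  collapse-edge {u = []} ne _ = ⊥-elim (ne refl)
  collapse-edge {i} {c ∷ u} {v} _ = head-edge i c u v

  -- A first letter c common to all left labels is moved into the index, shortening the left labels.
  common-head : ∀ m → NoClosedWalkBelow m → ∀ i c w ws → leftLength (w ∷ ws) ≤ suc m →
                ClosedWalk (E i) w ws → All (StartsWith c ∘ proj₁) (w ∷ ws) →
                PrefixFree (map proj₁ (w ∷ ws)) → Q (map proj₂ (w ∷ ws)) → ⊥
  common-head m below i c w@(_ ∷ u , _) ws bound cyc starts@(refl ∷ _) pf q =
    below (push c i) (strip w) (map strip ws) shorter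
      (ClosedWalk-map (drop 1) id (StartsWith c) (λ _ → ⊤) edge⁺ drop1-injective (λ _ _ ne → ne)
         w ws (All.map (_, tt) starts) cyc)
      (subst PrefixFree (lefts-strip (w ∷ ws)) (PrefixFree-drop1 (All.map⁺ starts) pf))
      (subst Q (rights-strip (w ∷ ws)) q)
    where
    edge⁺ : ∀ {u v} → StartsWith c u → ⊤ → E i u v → E (push c i) (drop 1 u) v
    edge⁺ {_ ∷ u} {v} refl _ = push-edge i c u v
    drop1-injective : ∀ {u u′} → StartsWith c u → StartsWith c u′ → u ≢ u′ → drop 1 u ≢ drop 1 u′
    drop1-injective {_ ∷ _} {_ ∷ _} refl refl ne e = ne (cong (c ∷_) e)
    shorter : leftLength (map strip (w ∷ ws)) ≤ m
    shorter = ≤-pred (≤-trans (s≤s (+-monoʳ-≤ (length u) (leftLength-strip ws))) bound)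

  module _ (i : I) where

    NoClosableRun : List A × List A → List (List A × List A) → Set
    NoClosableRun q qs = ∀ y ys → y ∷ ys ⊑ q ∷ qs → ClosableʳWalk (E i) y ys →
                         All (SameLeftHead y) (y ∷ ys) → ⊥

    -- Replacing every left label by its first letter and merging the maximal runs of edges
    -- whose left labels share that letter; run is the first such run.
    record Compression (q : List A × List A) (qs : List (List A × List A)) : Set where
      field
        start : List A × List A
        rest : List (List A × List A)
        walk : Walk (E i) start rest
        singletons : Singletons (map proj₁ (start ∷ rest))
        rights⊆ : map proj₂ (start ∷ rest) ⊆ map proj₂ (q ∷ qs)
        start-left : proj₁ start ≡ take 1 (proj₁ q)
        run : List (List A × List A)
        run⊑ : q ∷ run ⊑ q ∷ qs
        run-steps : Linked (Step (E i)) (q ∷ run)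
        run-same : All (SameLeftHead q) (q ∷ run)
        start-right : proj₂ start ≡ proj₂ (lastOf q run)
        last≡ : lastOf start rest ≡ collapse (lastOf q qs)

    open Compression

    compress : ∀ q qs → Walk (E i) q qs → All NonemptyLeft (q ∷ qs) → NoClosableRun q qs → Compression q qs
    compress q [] (e ∷ [] , _) (ne ∷ []) _ = record
      { start = collapse q ; rest = [] ; walk = collapse-edge ne e ∷ [] , [-]
      ; singletons = take1-singleton ne ∷ [] ; rights⊆ = id ; start-left = refl
      ; run = [] ; run⊑ = ⊆-refl ; run-steps = [-] ; run-same = sameHead-refl ne ∷ []
      ; start-right = refl ; last≡ = refl }
    compress q (q′ ∷ qs) (e ∷ es , s ∷ ss) (ne ∷ nes) noRun
      with compress q′ qs (es , ss) nes (λ y ys sub → noRun y ys (q ∷ʳ sub)) | sameHead? (proj₁ q) (proj₁ q′)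
    ... | c | yes same = record
      { start = start c ; rest = rest c ; walk = walk c ; singletons = singletons c
      ; rights⊆ = there ∘ rights⊆ c ; start-left = trans (start-left c) (sym (sameHead⇒take≡ same))
      ; run = q′ ∷ run c ; run⊑ = refl ∷ run⊑ c ; run-steps = s ∷ run-steps c
      ; run-same = sameHead-refl ne ∷ All.map (sameHead-trans same) (run-same c)
      ; start-right = start-right c ; last≡ = last≡ c }
    ... | c | no diff with proj₂ q ≟ʷ proj₂ (start c)
    ...   | yes eq = ⊥-elim (noRun q′ (run c) (q ∷ʳ run⊑ c)
              ( (All-resp-⊆ (run⊑ c) es , run-steps c)
              , subst (E i (proj₁ q′)) (trans eq (start-right c)) (proj₁ s)
              , λ e′ → proj₂ (proj₂ s) (trans (trans eq (start-right c)) e′) )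
              (run-same c))
    ...   | no neq = record
      { start = collapse q ; rest = start c ∷ rest c
      ; walk = collapse-edge ne e ∷ proj₁ (walk c)
             , ( subst (λ t → E i t (proj₂ q)) (sym (start-left c)) (collapse-edge (All.head nes) (proj₁ s))
               , (λ e′ → ¬sameHead⇒take≢ ne (All.head nes) diff (trans e′ (start-left c)))
               , neq ) ∷ proj₂ (walk c)
      ; singletons = take1-singleton ne ∷ singletons c
      ; rights⊆ = λ { (here e′) → here e′ ; (there j) → there (rights⊆ c j) }
      ; start-left = refl ; run = [] ; run⊑ = refl ∷ []⊆-universal _ ; run-steps = [-]
      ; run-same = sameHead-refl ne ∷ [] ; start-right = refl ; last≡ = last≡ c }

    head-change-impossible : ∀ y ys → ClosedWalk (E i) y ys → All NonemptyLeft (y ∷ ys) →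
                             ¬ SameLeftHead (lastOf y ys) y → NoClosableRun y ys →
                             Q (map proj₂ (y ∷ ys)) → ⊥
    head-change-impossible y ys (walk₀ , closing) nes diff noRun q
      with compress y ys walk₀ nes noRun
    ... | c with proj₂ (lastOf y ys) ≟ʷ proj₂ (start c)
    ...   | yes eq = noRun y (run c) (run⊑ c)
              ( (All-resp-⊆ (run⊑ c) (proj₁ walk₀) , run-steps c)
              , subst (E i (proj₁ y)) (trans eq (start-right c)) (proj₁ closing)
              , λ e′ → proj₂ (proj₂ closing) (trans (trans eq (start-right c)) e′) )
              (run-same c)
    ...   | no neq = base i (start c) (rest c)
              ( walk c
              , subst (λ t → Step (E i) t (start c)) (sym (last≡ c))
                  ( subst (λ t → E i t (proj₂ (lastOf y ys))) (sym (start-left c))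
                      (collapse-edge (All.head nes) (proj₁ closing))
                  , (λ e′ → ¬sameHead⇒take≢ (All.lookup nes (lastOf-∈ y ys)) (All.head nes) diff
                              (trans e′ (start-left c)))
                  , neq ) )
              (singletons c) (Q-⊆ (rights⊆ c) q)

  -- Induction on the total length of the left labels. Unless they all begin with the same letter,
  -- the walk is rotated to start where the first letter changes and then compressed.
  no-closed-walk-below : ∀ m → NoClosedWalkBelow m
  no-closed-walk-below m i ([] , v) xs bound cyc pf q = All.head (nonempty-lefts cyc pf) refl
  no-closed-walk-below zero i (c ∷ u , v) xs () cyc pf q
  no-closed-walk-below (suc m) i x@(c ∷ u , v) xs bound cyc pf q
    with First.first (λ p → toSum (startsWith? c (proj₁ p))) xs
  ... | inj₂ allStart = common-head m (no-closed-walk-below m) i c x xs bound cyc (refl ∷ allStart) pf q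
  ... | inj₁ firstOther with toView firstOther
  ...   | First._++_∷_ {pre} {y} starts other post =
    head-change-impossible i y (post ++ x ∷ pre) (ClosedWalk-rotate (E i) x pre y post cyc)
      (All.tabulate (All.lookup nes ∘ rotate-⊆ x pre y post)) headChange noRun
      (Q-⊆ (⊆-map⁺ proj₂ (rotate-⊆ x pre y post)) q)
    where
    nes : All NonemptyLeft (x ∷ pre ++ y ∷ post)
    nes = nonempty-lefts cyc pf
    headChange : ¬ SameLeftHead (lastOf y (post ++ x ∷ pre)) y
    headChange same = other (startsWith-sameHead
      (subst (StartsWith c ∘ proj₁) (sym (lastOf-++ y post x pre)) (All.lookup (refl ∷ starts) (lastOf-∈ x pre)))
      same)
    -- A closable run yields a closed walk whose left labels share their first letter.
    noRun : NoClosableRun i y (post ++ x ∷ pre)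
    noRun z zs sub closable same
      with closeʳ (E i) _≟ʷ_ _≟ʷ_ (length zs) z zs ≤-refl closable
    ... | t , ts , sub′ , cyc′
      with nonempty-head (All.lookup nes (rotate-⊆ x pre y post (Sublist.lookup sub (here refl))))
    ... | c′ , zStarts =
      common-head m (no-closed-walk-below m) i c′ t ts bound′ cyc′
        (All-resp-⊆ sub′ (All.map (startsWith-sameHead zStarts) same))
        (PrefixFree-⊆ (⊆-map⁺ proj₁ incl) pf) (Q-⊆ (⊆-map⁺ proj₂ incl) q)
      where
      incl : t ∷ ts ⊆ x ∷ pre ++ y ∷ post
      incl = rotate-⊆ x pre y post ∘ Sublist.lookup sub ∘ Sublist.lookup sub′
      bound′ : leftLength (t ∷ ts) ≤ suc m
      bound′ = ≤-trans (leftLength-⊑ sub′) (≤-trans (leftLength-⊑ sub)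
                 (≤-trans (≤-reflexive (leftLength-rotate x pre y post)) bound))

  no-closed-walk : ∀ i x xs → ClosedWalk (E i) x xs → PrefixFree (map proj₁ (x ∷ xs)) → Q (map proj₂ (x ∷ xs)) → ⊥
  no-closed-walk i x xs = no-closed-walk-below (leftLength (x ∷ xs)) i x xs ≤-refl

-- Prefix-free left labels are reduced to singletons; transposing, the same reduction applied to the
-- right labels then reaches the base case.
module _ {A : Set} (_≟_ : DecidableEquality A)
  (I : Set) (E : I → List A → List A → Set) (pushˡ pushʳ : A → I → I)
  (pushˡ-edge : ∀ i c u v → E i (c ∷ u) v → E (pushˡ c i) u v)
  (pushʳ-edge : ∀ i c u v → E i u (c ∷ v) → E (pushʳ c i) u v)
  (headˡ-edge : ∀ i c u v → E i (c ∷ u) v → E i [ c ] v)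
  (headʳ-edge : ∀ i c u v → E i u (c ∷ v) → E i u [ c ])
  (base : ∀ i x xs → ClosedWalk (E i) x xs →
          Singletons (map proj₁ (x ∷ xs)) → Singletons (map proj₂ (x ∷ xs)) → ⊥)
  where

  private
    Eᵀ : I → List A → List A → Set
    Eᵀ i = flip (E i)

    baseᵀ : ∀ i x xs → ClosedWalk (Eᵀ i) x xs →
            Singletons (map proj₁ (x ∷ xs)) → Singletons (map proj₂ (x ∷ xs)) → ⊥
    baseᵀ i x xs cyc sˡ sʳ with ClosedWalk-transpose (Eᵀ i) x xs cyc
    ... | y , ys , cyc′ , lefts⊆ , rights⊆ = base i y ys cyc′ (Singletons-⊆ lefts⊆ sʳ) (Singletons-⊆ rights⊆ sˡ)

    module RightReduction =
      LeftReduction _≟_ I Eᵀ pushʳ (λ i c v u → pushʳ-edge i c u v) (λ i c v u → headʳ-edge i c u v)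
        Singletons Singletons-⊆ baseᵀ

    singletonsˡ : ∀ i x xs → ClosedWalk (E i) x xs →
                  Singletons (map proj₁ (x ∷ xs)) → PrefixFree (map proj₂ (x ∷ xs)) → ⊥
    singletonsˡ i x xs cyc sˡ pfʳ with ClosedWalk-transpose (E i) x xs cyc
    ... | y , ys , cyc′ , lefts⊆ , rights⊆ =
      RightReduction.no-closed-walk i y ys cyc′ (PrefixFree-⊆ lefts⊆ pfʳ) (Singletons-⊆ rights⊆ sˡ)

  open LeftReduction _≟_ I E pushˡ pushˡ-edge headˡ-edge PrefixFree PrefixFree-⊆ singletonsˡ
    public using () renaming (no-closed-walk to no-prefix-free-closed-walk)

module _ {n : ℕ} {S : Lang n} (factorial : Factorial S) where

  suffix-closed : ∀ (u v : Word n) → S (u ++ v) → S v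
  suffix-closed u v s = factorial u v [] (subst (λ t → S (u ++ t)) (sym (++-identityʳ v)) s)

  prefix-closed : ∀ (u v : Word n) → S (u ++ v) → S u
  prefix-closed u v = factorial [] u v

module GeneralizedExtensions {n : ℕ} (S : Lang n) (acyclic : Acyclic S) where

  private
    factorial : Factorial S
    factorial = proj₁ (proj₁ acyclic)

  -- Left labels are stored reversed, so that their letter adjacent to the middle word comes first.
  GenExt : Word n → Word n → Word n → Set
  GenExt w u v = S (reverse u ++ w ++ v)

  private
    reverse-∷-++ : ∀ (c : Letter n) u z → reverse (c ∷ u) ++ z ≡ reverse u ++ c ∷ z
    reverse-∷-++ c u z = trans (cong (_++ z) (unfold-reverse c u)) (++-assoc (reverse u) [ c ] z)

    pushˡ-edge : ∀ w c u v → GenExt w (c ∷ u) v → GenExt (c ∷ w) u v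
    pushˡ-edge w c u v = subst S (reverse-∷-++ c u (w ++ v))

    pushʳ-edge : ∀ w c u v → GenExt w u (c ∷ v) → GenExt (w ++ [ c ]) u v
    pushʳ-edge w c u v = subst S (cong (reverse u ++_) (sym (++-assoc w [ c ] v)))

    headˡ-edge : ∀ w c u v → GenExt w (c ∷ u) v → GenExt w [ c ] v
    headˡ-edge w c u v e = suffix-closed factorial (reverse u) (c ∷ w ++ v) (pushˡ-edge w c u v e)

    headʳ-edge : ∀ w c u v → GenExt w u (c ∷ v) → GenExt w u [ c ]
    headʳ-edge w c u v e =
      prefix-closed factorial (reverse u ++ w ++ [ c ]) v (subst S (sym (++-assoc (reverse u) (w ++ [ c ]) v)) (pushʳ-edge w c u v e))

    -- Only ever applied to singletons; the value at [] is irrelevant.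
    first : Word n → Letter n
    first [] = zero
    first (a ∷ _) = a

    first-injective : ∀ {u u′ : Word n} → Singleton u → Singleton u′ → u ≢ u′ → first u ≢ first u′
    first-injective (_ , refl) (_ , refl) ne e = ne (cong [_] e)

    singleton-edge : ∀ {w u v : Word n} → Singleton u → Singleton v → GenExt w u v → Ext S w (first u) (first v)
    singleton-edge (_ , refl) (_ , refl) e = e

    both-singletons : ∀ (ps : List (Word n × Word n)) → Singletons (map proj₁ ps) → Singletons (map proj₂ ps) →
                      All (λ p → Singleton (proj₁ p) × Singleton (proj₂ p)) ps
    both-singletons [] _ _ = []
    both-singletons (p ∷ ps) (sˡ ∷ sˡs) (sʳ ∷ sʳs) = (sˡ , sʳ) ∷ both-singletons ps sˡs sʳs

    simple-closed-walk⇒cycle : ∀ w y y′ ys → ClosedWalk (Ext S w) y (y′ ∷ ys) →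
      Unique (map proj₁ (y ∷ y′ ∷ ys)) → Unique (map proj₂ (y ∷ y′ ∷ ys)) → ExtCycle S w
    simple-closed-walk⇒cycle w y y′ ys ((edges , steps) , closing) uniqueˡ uniqueʳ = record
      { k = length ys
      ; as = λ j → proj₁ (lookup ps j)
      ; bs = λ j → proj₂ (lookup ps j)
      ; as-inj = λ {i} {j} → Unique-map-lookup proj₁ ps uniqueˡ i j
      ; bs-inj = λ {i} {j} → Unique-map-lookup proj₂ ps uniqueʳ i j
      ; edge₁ = λ j → All.lookup edges (∈-lookup j)
      ; edge₂ = λ j → proj₁ (Linked-lookup y (y′ ∷ ys) steps j)
      ; edge₃ = subst (λ t → Ext S w (proj₁ y) (proj₂ t)) (sym (lookup-last y (y′ ∷ ys))) (proj₁ closing)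
      }
      where
      ps = y ∷ y′ ∷ ys

    singleton-closed-walk : ∀ w x xs → ClosedWalk (GenExt w) x xs →
      Singletons (map proj₁ (x ∷ xs)) → Singletons (map proj₂ (x ∷ xs)) → ⊥
    singleton-closed-walk w x xs cyc sˡ sʳ
      with simplify (Ext S w) _≟ᶠ_ _≟ᶠ_ (length xs) _ _ (≤-reflexive (length-map _ xs))
             (ClosedWalk-map first first Singleton Singleton singleton-edge first-injective first-injective
                x xs (both-singletons (x ∷ xs) sˡ sʳ) cyc)
    ... | y , ys , _ , cyc′ , uniqueˡ , uniqueʳ with ClosedWalk-has-two-edges (Ext S w) cyc′
    ... | y′ , ys′ , refl , _ =
      proj₂ acyclic w (factorial [ proj₁ y ] w [ proj₂ y ] (All.head (proj₁ (proj₁ cyc′))))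
        (simple-closed-walk⇒cycle w y y′ ys′ cyc′ uniqueˡ uniqueʳ)

  no-prefix-free-generalized-cycle : ∀ w x xs → ClosedWalk (GenExt w) x xs →
    PrefixFree (map proj₁ (x ∷ xs)) → PrefixFree (map proj₂ (x ∷ xs)) → ⊥
  no-prefix-free-generalized-cycle =
    no-prefix-free-closed-walk _≟ᶠ_ (Word n) GenExt _∷_ (λ c w → w ++ [ c ])
      pushˡ-edge pushʳ-edge headˡ-edge headʳ-edge singleton-closed-walk

-- The incidence graph of X

module IncidenceGraph {n : ℕ} (S X : Lang n) (acyclic : Acyclic S) (bifix : BifixCode X)
                      (X⊆S : ∀ x → X x → S x) where

  open GeneralizedExtensions S acyclic using (GenExt; no-prefix-free-generalized-cycle)

  factorial : Factorial S
  factorial = proj₁ (proj₁ acyclic)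

  no-proper-prefix : ∀ u s → X u → X (u ++ s) → s ≢ [] → ⊥
  no-proper-prefix = proj₁ (proj₂ bifix)

  no-proper-suffix : ∀ u s → X u → X (s ++ u) → s ≢ [] → ⊥
  no-proper-suffix = proj₂ (proj₂ bifix)

  S-drop-prefix : ∀ (s u v : Word n) → X (s ++ u ++ v) → S (u ++ v)
  S-drop-prefix s u v x = suffix-closed factorial s (u ++ v) (X⊆S _ x)

  S-drop-suffix : ∀ (u v s : Word n) → X (u ++ v ++ s) → S (u ++ v)
  S-drop-suffix u v s x = prefix-closed factorial (u ++ v) s (X⊆S _ (subst X (sym (++-assoc u v s)) x))

  -- inj₁ u is the vertex of the prefix u and inj₂ v that of the suffix v, joined when u v ∈ X.
  Vertex : Set
  Vertex = Word n ⊎ Word n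

  _≟ᵛ_ : DecidableEquality Vertex
  _≟ᵛ_ = ≡-dec⊎ (≡-decᴸ _≟ᶠ_) (≡-decᴸ _≟ᶠ_)

  AdjX AdjS : Vertex → Vertex → Set
  AdjX (inj₁ u) (inj₂ v) = X (u ++ v) × v ≢ []
  AdjX (inj₂ v) (inj₁ u) = X (u ++ v) × v ≢ []
  AdjX _ _ = ⊥
  AdjS (inj₁ u) (inj₂ v) = S (u ++ v)
  AdjS (inj₂ v) (inj₁ u) = S (u ++ v)
  AdjS _ _ = ⊥

  AdjX⇒AdjS : ∀ {a b} → AdjX a b → AdjS a b
  AdjX⇒AdjS {inj₁ u} {inj₂ v} (x , _) = X⊆S _ x
  AdjX⇒AdjS {inj₂ v} {inj₁ u} (x , _) = X⊆S _ x

  AdjX-sym : ∀ {a b} → AdjX a b → AdjX b a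
  AdjX-sym {inj₁ u} {inj₂ v} e = e
  AdjX-sym {inj₂ v} {inj₁ u} e = e

  NoProperSuffix NoProperPrefix : Word n → Word n → Set
  NoProperSuffix u u′ = ∀ c → u′ ≡ c ++ u → c ≡ []
  NoProperPrefix v v′ = ∀ c → v′ ≡ v ++ c → c ≡ []

  Compatible : Vertex → Vertex → Set
  Compatible (inj₁ u) (inj₁ u′) = NoProperSuffix u u′ × NoProperSuffix u′ u
  Compatible (inj₂ v) (inj₂ v′) = NoProperPrefix v v′ × NoProperPrefix v′ v
  Compatible _ _ = ⊤

  PairwiseCompatible : List Vertex → Set
  PairwiseCompatible l = ∀ {a b} → a ∈ l → b ∈ l → Compatible a b

  Compatible-refl : ∀ a → Compatible a a
  Compatible-refl (inj₁ u) = (λ c → ++-identityˡ-unique c) , (λ c → ++-identityˡ-unique c)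
  Compatible-refl (inj₂ v) = (λ c → ++-identityʳ-unique v) , (λ c → ++-identityʳ-unique v)

  Compatible-sym : ∀ a b → Compatible a b → Compatible b a
  Compatible-sym (inj₁ _) (inj₁ _) (p , q) = q , p
  Compatible-sym (inj₁ _) (inj₂ _) _ = tt
  Compatible-sym (inj₂ _) (inj₁ _) _ = tt
  Compatible-sym (inj₂ _) (inj₂ _) (p , q) = q , p

  PairwiseCompatible-⊆ : ∀ {l l′} → l′ ⊆ l → PairwiseCompatible l → PairwiseCompatible l′
  PairwiseCompatible-⊆ sub pc i j = pc (sub i) (sub j)

  PairwiseCompatible-∷ : ∀ {z l} → PairwiseCompatible l → (∀ {w} → w ∈ l → Compatible z w) →
                         PairwiseCompatible (z ∷ l)
  PairwiseCompatible-∷ {z} pc new (here refl) (here refl) = Compatible-refl z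
  PairwiseCompatible-∷ pc new (here refl) (there j) = new j
  PairwiseCompatible-∷ {z} pc new (there i) (here refl) = Compatible-sym z _ (new i)
  PairwiseCompatible-∷ pc new (there i) (there j) = pc i j

  NonemptySuffix : Vertex → Set
  NonemptySuffix (inj₁ _) = ⊤
  NonemptySuffix (inj₂ v) = v ≢ []

  private
    source-nonempty : ∀ {x y} → AdjX x y → NonemptySuffix x
    source-nonempty {inj₁ _} {inj₂ _} _ = tt
    source-nonempty {inj₂ _} {inj₁ _} (_ , ne) = ne

    target-nonempty : ∀ {x y} → AdjX x y → NonemptySuffix y
    target-nonempty {inj₁ _} {inj₂ _} (_ , ne) = ne
    target-nonempty {inj₂ _} {inj₁ _} _ = tt

  path-suffixes-nonempty : ∀ {x y rest} → Linked AdjX (x ∷ y ∷ rest) → All NonemptySuffix (x ∷ y ∷ rest)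
  path-suffixes-nonempty {rest = []} (r ∷ _) = source-nonempty r ∷ target-nonempty r ∷ []
  path-suffixes-nonempty {rest = _ ∷ _} (r ∷ steps) = source-nonempty r ∷ path-suffixes-nonempty steps

  private
    reversed-edge : ∀ u v → S (u ++ v) → GenExt [] (reverse u) v
    reversed-edge u v = subst S (cong (_++ v) (sym (reverse-involutive u)))

    IsSuffixVertex : Vertex → Set
    IsSuffixVertex (inj₁ _) = ⊥
    IsSuffixVertex (inj₂ _) = ⊤

  -- The alternating S-path u v u₁ v₁ ⋯ read as a walk (u ʳ, v), (u₁ ʳ, v₁), ⋯ in the extension
  -- graph of the empty word.
  record AsExtWalk (u v : Word n) (rest : List Vertex) : Set where
    field
      pairs : List (Word n × Word n)
      walk : Walk (GenExt []) (reverse u , v) pairs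
      lastˡ lastʳ : Word n
      last-pair : lastOf (reverse u , v) pairs ≡ (reverse lastˡ , lastʳ)
      last-vertex : lastOf (inj₂ v) rest ≡ inj₂ lastʳ
      lastˡ-from : (rest ≡ [] × lastˡ ≡ u) ⊎ inj₁ lastˡ ∈ rest
      lefts-from : ∀ {a} → a ∈ map proj₁ ((reverse u , v) ∷ pairs) →
                   ∃[ u′ ] (a ≡ reverse u′ × inj₁ u′ ∈ inj₁ u ∷ inj₂ v ∷ rest)
      rights-from : ∀ {b} → b ∈ map proj₂ ((reverse u , v) ∷ pairs) → inj₂ b ∈ inj₁ u ∷ inj₂ v ∷ rest

  asExtWalk : ∀ u v rest → Linked AdjS (inj₁ u ∷ inj₂ v ∷ rest) → Unique (inj₁ u ∷ inj₂ v ∷ rest) →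
              IsSuffixVertex (lastOf (inj₂ v) rest) → AsExtWalk u v rest
  asExtWalk u v [] (e ∷ _) _ _ = record
    { pairs = [] ; walk = reversed-edge u v e ∷ [] , [-] ; lastˡ = u ; lastʳ = v
    ; last-pair = refl ; last-vertex = refl ; lastˡ-from = inj₁ (refl , refl)
    ; lefts-from = λ { (here e′) → u , e′ , here refl }
    ; rights-from = λ { (here e′) → there (here (cong inj₂ e′)) } }
  asExtWalk u v (inj₂ _ ∷ _) (_ ∷ () ∷ _) _ _
  asExtWalk u v (inj₁ u′ ∷ []) _ _ ()
  asExtWalk u v (inj₁ u′ ∷ inj₁ _ ∷ _) (_ ∷ _ ∷ () ∷ _) _ _
  asExtWalk u v (inj₁ u′ ∷ inj₂ v′ ∷ rest) (e₁ ∷ e₂ ∷ steps) ((_ ∷ u∉) ∷ (_ ∷ v∉) ∷ unique) suffixEnd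
    with asExtWalk u′ v′ rest steps unique suffixEnd
  ... | w = record
    { pairs = (reverse u′ , v′) ∷ pairs w
    ; walk = reversed-edge u v e₁ ∷ proj₁ (walk w)
           , ( reversed-edge u′ v e₂
             , (λ e → All.head u∉ (cong inj₁ (reverse-injective e)))
             , (λ e → All.head v∉ (cong inj₂ e)) )
             ∷ proj₂ (walk w)
    ; lastˡ = lastˡ w ; lastʳ = lastʳ w ; last-pair = last-pair w ; last-vertex = last-vertex w
    ; lastˡ-from = inj₂ (there-lastˡ (lastˡ-from w))
    ; lefts-from = λ { (here e) → u , e , here refl
                     ; (there i) → let (u″ , e , j) = lefts-from w i in u″ , e , there (there j) }
    ; rights-from = λ { (here e) → there (here (cong inj₂ e)) ; (there i) → there (there (rights-from w i)) } }
    where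
    open AsExtWalk
    there-lastˡ : (rest ≡ [] × lastˡ w ≡ u′) ⊎ inj₁ (lastˡ w) ∈ rest →
                  inj₁ (lastˡ w) ∈ inj₁ u′ ∷ inj₂ v′ ∷ rest
    there-lastˡ (inj₁ (_ , refl)) = here refl
    there-lastˡ (inj₂ i) = there (there i)

  private
    reverse-suffix : ∀ (u₁ u₂ c : Word n) → reverse u₂ ≡ reverse u₁ ++ c → u₂ ≡ reverse c ++ u₁
    reverse-suffix u₁ u₂ c e = begin
      u₂                               ≡⟨ sym (reverse-involutive u₂) ⟩
      reverse (reverse u₂)             ≡⟨ cong reverse e ⟩
      reverse (reverse u₁ ++ c)        ≡⟨ reverse-++ (reverse u₁) c ⟩
      reverse c ++ reverse (reverse u₁) ≡⟨ cong (reverse c ++_) (reverse-involutive u₁) ⟩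
      reverse c ++ u₁                  ∎
      where open ≡-Reasoning

  no-compatible-S-cycle : ∀ u v rest → rest ≢ [] → Linked AdjS (inj₁ u ∷ inj₂ v ∷ rest) →
    AdjS (lastOf (inj₂ v) rest) (inj₁ u) → Unique (inj₁ u ∷ inj₂ v ∷ rest) →
    PairwiseCompatible (inj₁ u ∷ inj₂ v ∷ rest) → ⊥
  no-compatible-S-cycle u v rest nonempty steps closing unique compatible
    with lastOf (inj₂ v) rest in lastEq
  ... | inj₁ _ = ⊥-elim closing
  ... | inj₂ _ with asExtWalk u v rest steps unique (subst IsSuffixVertex (sym lastEq) tt)
  ...   | w = no-prefix-free-generalized-cycle [] (reverse u , v) (pairs w)
                ( walk w
                , subst (λ t → Step (GenExt []) t (reverse u , v)) (sym (last-pair w))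
                    (closing-edge , distinctˡ (lastˡ-from w) , distinctʳ rest nonempty unique (last-vertex w)) )
                prefixFreeˡ prefixFreeʳ
    where
    open AsExtWalk
    closing-edge : GenExt [] (reverse u) (lastʳ w)
    closing-edge = reversed-edge u (lastʳ w)
      (subst (λ t → S (u ++ t)) (inj₂-injective (trans (sym lastEq) (last-vertex w))) closing)
    distinctˡ : (rest ≡ [] × lastˡ w ≡ u) ⊎ inj₁ (lastˡ w) ∈ rest → reverse (lastˡ w) ≢ reverse u
    distinctˡ (inj₁ (empty , _)) _ = nonempty empty
    distinctˡ (inj₂ i) e = All.lookup (AllPairs.head unique) (there i) (cong inj₁ (sym (reverse-injective e)))
    distinctʳ : ∀ rs → rs ≢ [] → Unique (inj₁ u ∷ inj₂ v ∷ rs) →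
                lastOf (inj₂ v) rs ≡ inj₂ (lastʳ w) → lastʳ w ≢ v
    distinctʳ [] ne _ _ _ = ne refl
    distinctʳ (y ∷ ys) _ (_ ∷ v∉ ∷ _) e e′ =
      All.lookup v∉ (subst (_∈ y ∷ ys) e (lastOf-∈ y ys)) (cong inj₂ (sym e′))
    prefixFreeˡ : PrefixFree (map proj₁ ((reverse u , v) ∷ pairs w))
    prefixFreeˡ i j c e with lefts-from w i | lefts-from w j
    ... | u₁ , refl , i₁ | u₂ , refl , i₂ =
      reverse-injective {y = []} (proj₁ (compatible i₁ i₂) (reverse c) (reverse-suffix u₁ u₂ c e))
    prefixFreeʳ : PrefixFree (map proj₂ ((reverse u , v) ∷ pairs w))
    prefixFreeʳ i j = proj₁ (compatible (rights-from w i) (rights-from w j))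

  suffix-neighbour : ∀ {a u} → AdjX a (inj₁ u) → ∃[ v ] (a ≡ inj₂ v × X (u ++ v) × v ≢ [])
  suffix-neighbour {inj₂ v} r = v , refl , r

  prefix-neighbour : ∀ {a v} → AdjX a (inj₂ v) → ∃[ u ] (a ≡ inj₁ u × X (u ++ v) × v ≢ [])
  prefix-neighbour {inj₁ u} r = u , refl , r

  private

    X-assoc : ∀ (a b c : Word n) → X ((a ++ b) ++ c) → X (a ++ b ++ c)
    X-assoc a b c = subst X (++-assoc a b c)

  -- If the end prefix uₖ were a proper suffix of u₀ (or conversely), the path would close up into
  -- an S-cycle, or, for a path of length two, X would not be a suffix code.
  path-prefixes-compatible : ∀ u₀ v₁ mid uₖ → Linked AdjX (inj₁ u₀ ∷ inj₂ v₁ ∷ mid ++ [ inj₁ uₖ ]) →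
    Unique (inj₁ u₀ ∷ inj₂ v₁ ∷ mid ++ [ inj₁ uₖ ]) → PairwiseCompatible (inj₁ u₀ ∷ inj₂ v₁ ∷ mid) →
    PairwiseCompatible (inj₂ v₁ ∷ mid ++ [ inj₁ uₖ ]) → NoProperSuffix u₀ uₖ × NoProperSuffix uₖ u₀
  path-prefixes-compatible u₀ v₁ [] uₖ ((x₀ , _) ∷ (xₖ , _) ∷ _) _ _ _ = extend₀ , extendₖ
    where
    extend₀ : NoProperSuffix u₀ uₖ
    extend₀ [] _ = refl
    extend₀ (d ∷ c) refl = ⊥-elim (no-proper-suffix (u₀ ++ v₁) (d ∷ c) x₀ (X-assoc (d ∷ c) u₀ v₁ xₖ) λ ())
    extendₖ : NoProperSuffix uₖ u₀
    extendₖ [] _ = refl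
    extendₖ (d ∷ c) refl = ⊥-elim (no-proper-suffix (uₖ ++ v₁) (d ∷ c) xₖ (X-assoc (d ∷ c) uₖ v₁ x₀) λ ())
  path-prefixes-compatible u₀ v₁ (y ∷ ys) uₖ steps unique compatible₀ compatibleₖ
    with Linked-split (inj₁ u₀) (inj₂ v₁ ∷ y ∷ ys) (inj₁ uₖ) [] steps
  ... | steps′ , last , _ with suffix-neighbour {lastOf y ys} last
  ... | vₖ , lastEq , xₖ , _ = extend₀ , extendₖ
    where
    x₀ : X (u₀ ++ v₁)
    x₀ = proj₁ (Linked.head steps)
    extend₀ : NoProperSuffix u₀ uₖ
    extend₀ [] _ = refl
    extend₀ (d ∷ c) refl = ⊥-elim (no-compatible-S-cycle u₀ v₁ (y ∷ ys) (λ ())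
      (Linked.map AdjX⇒AdjS steps′)
      (subst (λ t → AdjS t (inj₁ u₀)) (sym lastEq) (S-drop-prefix (d ∷ c) u₀ vₖ (X-assoc (d ∷ c) u₀ vₖ xₖ)))
      (Unique-⊑ (++⁺ʳ [ inj₁ uₖ ] ⊆-refl) unique) compatible₀)
    extendₖ : NoProperSuffix uₖ u₀
    extendₖ [] _ = refl
    extendₖ (d ∷ c) refl = ⊥-elim (no-compatible-S-cycle uₖ v₁ (y ∷ ys) (λ ())
      (S-drop-prefix (d ∷ c) uₖ v₁ (X-assoc (d ∷ c) uₖ v₁ x₀) ∷ Linked.tail (Linked.map AdjX⇒AdjS steps′))
      (subst (λ t → AdjS t (inj₁ uₖ)) (sym lastEq) (X⊆S _ xₖ))
      (Unique-resp-↭ (AllPairs.tail unique) (++-comm (inj₂ v₁ ∷ y ∷ ys) [ inj₁ uₖ ]))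
      (PairwiseCompatible-⊆ (∈-resp-↭ (++-comm [ inj₁ uₖ ] (inj₂ v₁ ∷ y ∷ ys))) compatibleₖ))

  -- Dually, with suffix vertices compared as prefixes of each other and X a prefix code.
  path-suffixes-compatible : ∀ v₀ u₁ mid vₖ → Linked AdjX (inj₂ v₀ ∷ inj₁ u₁ ∷ mid ++ [ inj₂ vₖ ]) →
    Unique (inj₂ v₀ ∷ inj₁ u₁ ∷ mid ++ [ inj₂ vₖ ]) → PairwiseCompatible (inj₂ v₀ ∷ inj₁ u₁ ∷ mid) →
    PairwiseCompatible (inj₁ u₁ ∷ mid ++ [ inj₂ vₖ ]) → NoProperPrefix v₀ vₖ × NoProperPrefix vₖ v₀
  path-suffixes-compatible v₀ u₁ [] vₖ ((x₀ , _) ∷ (xₖ , _) ∷ _) _ _ _ = extend₀ , extendₖ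
    where
    extend₀ : NoProperPrefix v₀ vₖ
    extend₀ [] _ = refl
    extend₀ (d ∷ c) refl =
      ⊥-elim (no-proper-prefix (u₁ ++ v₀) (d ∷ c) x₀ (subst X (sym (++-assoc u₁ v₀ (d ∷ c))) xₖ) λ ())
    extendₖ : NoProperPrefix vₖ v₀
    extendₖ [] _ = refl
    extendₖ (d ∷ c) refl =
      ⊥-elim (no-proper-prefix (u₁ ++ vₖ) (d ∷ c) xₖ (subst X (sym (++-assoc u₁ vₖ (d ∷ c))) x₀) λ ())
  path-suffixes-compatible v₀ u₁ (inj₁ _ ∷ _) vₖ (_ ∷ () ∷ _) _ _ _
  path-suffixes-compatible v₀ u₁ (inj₂ v₂ ∷ ys) vₖ steps unique compatible₀ compatibleₖ
    with Linked-split (inj₂ v₀) (inj₁ u₁ ∷ inj₂ v₂ ∷ ys) (inj₂ vₖ) [] steps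
  ... | steps′ , last , _ with prefix-neighbour {lastOf (inj₂ v₂) ys} last
  ... | uₖ , lastEq , xₖ , _ = extend₀ , extendₖ
    where
    x₀ : X (u₁ ++ v₀)
    x₀ = proj₁ (Linked.head steps)
    closes : ∀ v → AdjS (lastOf (inj₂ v₂) (ys ++ [ inj₂ v ])) (inj₁ u₁) ≡ S (u₁ ++ v)
    closes v = cong (λ t → AdjS t (inj₁ u₁)) (lastOf-++ (inj₂ v₂) ys (inj₂ v) [])
    extend₀ : NoProperPrefix v₀ vₖ
    extend₀ [] _ = refl
    extend₀ (d ∷ c) refl = ⊥-elim (no-compatible-S-cycle u₁ v₂ (ys ++ [ inj₂ v₀ ]) (∷ʳ-nonempty ys _)
      (Linked-join (inj₁ u₁) (inj₂ v₂ ∷ ys) (inj₂ v₀) [] (Linked.tail (Linked.map AdjX⇒AdjS steps′))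
        (subst (λ t → AdjS t (inj₂ v₀)) (sym lastEq) (S-drop-suffix uₖ v₀ (d ∷ c) xₖ)) [-])
      (subst id (sym (closes v₀)) (X⊆S _ x₀))
      (Unique-resp-↭ (Unique-⊑ (++⁺ʳ [ inj₂ vₖ ] ⊆-refl) unique)
        (++-comm [ inj₂ v₀ ] (inj₁ u₁ ∷ inj₂ v₂ ∷ ys)))
      (PairwiseCompatible-⊆ (∈-resp-↭ (++-comm (inj₁ u₁ ∷ inj₂ v₂ ∷ ys) [ inj₂ v₀ ])) compatible₀))
    extendₖ : NoProperPrefix vₖ v₀
    extendₖ [] _ = refl
    extendₖ (d ∷ c) refl = ⊥-elim (no-compatible-S-cycle u₁ v₂ (ys ++ [ inj₂ vₖ ]) (∷ʳ-nonempty ys _)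
      (Linked.map AdjX⇒AdjS (Linked.tail steps))
      (subst id (sym (closes vₖ)) (S-drop-suffix u₁ vₖ (d ∷ c) x₀))
      (AllPairs.tail unique) compatibleₖ)

  EndpointsCompatible : ℕ → Set
  EndpointsCompatible N = ∀ x l → length l ≤ N → Linked AdjX (x ∷ l) → Unique (x ∷ l) → Compatible x (lastOf x l)

  private
    path-to : ∀ (z : Vertex) zs {b} → b ∈ z ∷ zs → ∃[ m ] ∃[ post ] (zs ≡ m ++ post × lastOf z m ≡ b)
    path-to z zs (here refl) = [] , zs , refl , refl
    path-to z (y ∷ ys) (there i) with path-to y ys i
    ... | m , post , e , last = y ∷ m , post , cong (y ∷_) e , last

    segment-between : ∀ (xs : List Vertex) {a b} → a ∈ xs → b ∈ xs →
      ∃[ pre ] ∃[ c ] ∃[ m ] ∃[ post ]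
        (xs ≡ pre ++ c ∷ m ++ post × ((c ≡ a × lastOf c m ≡ b) ⊎ (c ≡ b × lastOf c m ≡ a)))
    segment-between (z ∷ zs) (here refl) j with path-to z zs j
    ... | m , post , e , last = [] , z , m , post , cong (z ∷_) e , inj₁ (refl , last)
    segment-between (z ∷ zs) (there i) (here refl) with path-to z zs (there i)
    ... | m , post , e , last = [] , z , m , post , cong (z ∷_) e , inj₂ (refl , last)
    segment-between (z ∷ zs) (there i) (there j) with segment-between zs i j
    ... | pre , c , m , post , e , ends = z ∷ pre , c , m , post , cong (z ∷_) e , ends

  pairwise-from-endpoints : ∀ N → EndpointsCompatible N →
    ∀ xs → length xs ≤ suc N → Linked AdjX xs → Unique xs → PairwiseCompatible xs
  pairwise-from-endpoints N endpoints xs bound steps unique {a} {b} i j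
    with segment-between xs i j
  ... | pre , c , m , post , refl , ends = oriented ends
    where
    compatible : Compatible c (lastOf c m)
    compatible = endpoints c m
      (≤-pred (≤-trans (length-mono-≤ (++⁺ˡ pre (++⁺ʳ post (⊆-refl {x = c ∷ m})))) bound))
      (Linked-++⁻ˡ c m (Linked-++⁻ʳ pre steps))
      (Unique-⊑ (++⁺ˡ pre (++⁺ʳ post ⊆-refl)) unique)
    oriented : (c ≡ a × lastOf c m ≡ b) ⊎ (c ≡ b × lastOf c m ≡ a) → Compatible a b
    oriented (inj₁ (refl , refl)) = compatible
    oriented (inj₂ (refl , refl)) = Compatible-sym c (lastOf c m) compatible

  simple-path-endpoints : ∀ N → EndpointsCompatible N
  simple-path-endpoints N x [] _ _ _ = Compatible-refl x
  simple-path-endpoints zero x (_ ∷ _) () _ _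
  simple-path-endpoints (suc N) x l bound steps unique with initLast l
  ... | [] = Compatible-refl x
  ... | mid ∷ʳ′ z = subst (Compatible x) (sym (lastOf-++ x mid z [])) (by-kind x mid z steps unique compatible₀ compatibleₖ)
    where
    compatible₀ : PairwiseCompatible (x ∷ mid)
    compatible₀ = pairwise-from-endpoints N (simple-path-endpoints N) (x ∷ mid)
      (subst (_≤ suc N) (length-∷ʳ mid z) bound) (Linked-++⁻ˡ x mid steps) (Unique-⊑ (refl ∷ ++⁺ʳ [ z ] ⊆-refl) unique)
    compatibleₖ : PairwiseCompatible (mid ++ [ z ])
    compatibleₖ = pairwise-from-endpoints N (simple-path-endpoints N) (mid ++ [ z ]) bound
      (Linked.tail steps) (AllPairs.tail unique)
    by-kind : ∀ x mid z → Linked AdjX (x ∷ mid ++ [ z ]) → Unique (x ∷ mid ++ [ z ]) →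
              PairwiseCompatible (x ∷ mid) → PairwiseCompatible (mid ++ [ z ]) → Compatible x z
    by-kind (inj₁ u₀) (inj₂ v₁ ∷ mid) (inj₁ uₖ) = path-prefixes-compatible u₀ v₁ mid uₖ
    by-kind (inj₁ _) [] (inj₁ _) (() ∷ _)
    by-kind (inj₁ _) (inj₁ _ ∷ _) _ (() ∷ _)
    by-kind (inj₁ _) _ (inj₂ _) _ _ _ _ = tt
    by-kind (inj₂ v₀) (inj₁ u₁ ∷ mid) (inj₂ vₖ) = path-suffixes-compatible v₀ u₁ mid vₖ
    by-kind (inj₂ _) [] (inj₂ _) (() ∷ _)
    by-kind (inj₂ _) (inj₂ _ ∷ _) _ (() ∷ _)
    by-kind (inj₂ _) _ (inj₁ _) _ _ _ _ = tt

  simple-path-compatible : ∀ xs → Linked AdjX xs → Unique xs → PairwiseCompatible xs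
  simple-path-compatible xs = pairwise-from-endpoints (length xs) (simple-path-endpoints (length xs)) xs (n≤1+n _)

-- The coset automaton

module CosetClasses {n : ℕ} (S X : Lang n) (acyclic : Acyclic S) (bifix : BifixCode X)
                    (X⊆S : ∀ x → X x → S x) where

  open IncidenceGraph S X acyclic bifix X⊆S

  Θ⇒Path : ∀ {p q} → Θ X p q → Path AdjX (inj₁ p) (inj₁ q)
  Θ⇒Path {p} (θ-refl _) = Path-refl AdjX (inj₁ p)
  Θ⇒Path {p} {q} (θ-gen c s xp xq) = inj₂ (c ∷ s) ∷ inj₁ q ∷ [] , (xp , λ ()) ∷ (xq , λ ()) ∷ [-] , refl
  Θ⇒Path (θ-sym t) = Path-sym AdjX AdjX-sym (Θ⇒Path t)
  Θ⇒Path (θ-trans t t′) = Path-trans AdjX (Θ⇒Path t) (Θ⇒Path t′)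

  Θ⇒SimplePath : ∀ {p q} → Θ X p q → SimplePath AdjX (inj₁ p) (inj₁ q)
  Θ⇒SimplePath t with Θ⇒Path t
  ... | l , steps , last = subst (SimplePath AdjX _) last (shorten AdjX _≟ᵛ_ (length l) _ l ≤-refl steps)

  Θ-empty : ∀ {p q} → Θ X p q → (p ≡ [] → q ≡ []) × (q ≡ [] → p ≡ [])
  Θ-empty (θ-refl _) = id , id
  Θ-empty (θ-gen c s xp xq) = only-empty xp xq , only-empty xq xp
    where
    only-empty : ∀ {p q} → X (p ++ c ∷ s) → X (q ++ c ∷ s) → p ≡ [] → q ≡ []
    only-empty {q = []} _ _ _ = refl
    only-empty {q = d ∷ q} x x′ refl = ⊥-elim (no-proper-suffix (c ∷ s) (d ∷ q) x x′ λ ())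
  Θ-empty (θ-sym t) = Product.swap (Θ-empty t)
  Θ-empty (θ-trans t t′) = proj₁ (Θ-empty t′) ∘ proj₁ (Θ-empty t) , proj₂ (Θ-empty t) ∘ proj₂ (Θ-empty t′)

  private
    X-reassoc : ∀ (u : Word n) a t → X (u ++ a ∷ t) → X ((u ++ [ a ]) ++ t)
    X-reassoc u a t = subst X (sym (++-assoc u [ a ] t))

    Unique-∷ʳ : ∀ {l : List Vertex} {z} → Unique l → All (_≢ z) l → Unique (l ++ [ z ])
    Unique-∷ʳ {l} {z} unique fresh =
      Unique-resp-↭ (All.map (λ ne e → ne (sym e)) fresh ∷ unique) (++-comm [ z ] l)

    PairwiseCompatible-∷ʳ : ∀ {l z} → PairwiseCompatible l → (∀ {w} → w ∈ l → Compatible z w) →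
                            PairwiseCompatible (l ++ [ z ])
    PairwiseCompatible-∷ʳ {l} {z} pc new =
      PairwiseCompatible-⊆ (∈-resp-↭ (++-comm l [ z ])) (PairwiseCompatible-∷ pc new)

  module _ (a : Letter n) where

    Lit-deterministic : ∀ {p q q′} → Lit X p a q → Lit X p a q′ → Θ X q q′
    Lit-deterministic (_ , inj₁ (pp , refl)) (_ , inj₁ (_ , refl)) = θ-refl pp
    Lit-deterministic (_ , inj₂ (_ , refl)) (_ , inj₂ (_ , refl)) = θ-refl (inj₁ refl)
    Lit-deterministic {p} (_ , inj₁ (inj₁ e , _)) (_ , inj₂ _) = ⊥-elim (∷ʳ-nonempty p a e)
    Lit-deterministic {p} (_ , inj₁ (inj₂ (c , s , x′) , _)) (_ , inj₂ (x , _)) =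
      ⊥-elim (no-proper-prefix (p ++ [ a ]) (c ∷ s) x x′ λ ())
    Lit-deterministic {p} (_ , inj₂ _) (_ , inj₁ (inj₁ e , _)) = ⊥-elim (∷ʳ-nonempty p a e)
    Lit-deterministic {p} (_ , inj₂ (x , _)) (_ , inj₁ (inj₂ (c , s , x′) , _)) =
      ⊥-elim (no-proper-prefix (p ++ [ a ]) (c ∷ s) x x′ λ ())

    Lit⇒S : ∀ {p q} → Lit X p a q → S (p ++ [ a ])
    Lit⇒S {p} (_ , inj₁ (inj₁ e , _)) = ⊥-elim (∷ʳ-nonempty p a e)
    Lit⇒S {p} (_ , inj₁ (inj₂ (c , s , x) , _)) = prefix-closed factorial (p ++ [ a ]) (c ∷ s) (X⊆S _ x)
    Lit⇒S (_ , inj₂ (x , _)) = X⊆S _ x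

    shared-suffix : ∀ u u′ t → X (u ++ a ∷ t) → X (u′ ++ a ∷ t) →
                    ∃[ q ] ∃[ q′ ] (Lit X u a q × Lit X u′ a q′ × Θ X q q′)
    shared-suffix u u′ [] x x′ =
      [] , [] , (inj₂ (a , [] , x) , inj₂ (x , refl)) , (inj₂ (a , [] , x′) , inj₂ (x′ , refl)) , θ-refl (inj₁ refl)
    shared-suffix u u′ (c ∷ s) x x′ = u ++ [ a ] , u′ ++ [ a ] ,
      (inj₂ (a , c ∷ s , x) , inj₁ (inj₂ (c , s , X-reassoc u a (c ∷ s) x) , refl)) ,
      (inj₂ (a , c ∷ s , x′) , inj₁ (inj₂ (c , s , X-reassoc u′ a (c ∷ s) x′) , refl)) ,
      θ-gen c s (X-reassoc u a (c ∷ s) x) (X-reassoc u′ a (c ∷ s) x′)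

    StartsWithᵃ : Vertex → Set
    StartsWithᵃ (inj₂ (b ∷ _)) = b ≡ a
    StartsWithᵃ _ = ⊥

    startsWithᵃ? : ∀ v → Dec (StartsWithᵃ v)
    startsWithᵃ? (inj₁ _) = no λ ()
    startsWithᵃ? (inj₂ []) = no λ ()
    startsWithᵃ? (inj₂ (b ∷ _)) = b ≟ᶠ a

    suffix-[a]-compatible : ∀ w → ¬ StartsWithᵃ w → NonemptySuffix w → Compatible (inj₂ [ a ]) w
    suffix-[a]-compatible (inj₁ _) _ _ = tt
    suffix-[a]-compatible (inj₂ []) _ ne = ⊥-elim (ne refl)
    suffix-[a]-compatible (inj₂ (b ∷ v)) other _ =
      (λ c e → ⊥-elim (other (∷-injectiveˡ e))) , (λ c e → ⊥-elim (other (sym (∷-injectiveˡ e))))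

    Deterministic : ℕ → Set
    Deterministic N = ∀ p l → length l ≤ N → Linked AdjX (inj₁ p ∷ l) → Unique (inj₁ p ∷ l) →
      ∀ {p′} → lastOf (inj₁ p) l ≡ inj₁ p′ → ∀ {q q′} → Lit X p a q → Lit X p′ a q′ → Θ X q q′

    -- A suffix vertex a t on the path is flanked by prefixes w, u′ with w a t, u′ a t ∈ X.
    split-at-suffix : ∀ N → Deterministic N → ∀ p bs v cs → StartsWithᵃ v → length (bs ++ v ∷ cs) ≤ suc N →
            Linked AdjX (inj₁ p ∷ bs ++ v ∷ cs) → Unique (inj₁ p ∷ bs ++ v ∷ cs) →
            ∀ {p′} → lastOf (inj₁ p) (bs ++ v ∷ cs) ≡ inj₁ p′ →
            ∀ {q q′} → Lit X p a q → Lit X p′ a q′ → Θ X q q′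
    split-at-suffix N det p bs (inj₂ (.a ∷ t)) [] refl bound steps unique e L L′
      with trans (sym (lastOf-++ (inj₁ p) bs (inj₂ (a ∷ t)) [])) e
    ... | ()
    split-at-suffix N det p bs (inj₂ (.a ∷ t)) (inj₂ _ ∷ cs) refl bound steps unique e L L′
      with Linked-split (inj₁ p) bs (inj₂ (a ∷ t)) _ steps
    ... | _ , _ , (() ∷ _)
    split-at-suffix N det p bs (inj₂ (.a ∷ t)) (inj₁ u′ ∷ cs) refl bound steps unique e L L′
      with Linked-split (inj₁ p) bs (inj₂ (a ∷ t)) _ steps
    ... | steps₁ , r , (r′ ∷ steps₂) with prefix-neighbour {lastOf (inj₁ p) bs} r
    ... | w , wEq , x , _ with shared-suffix w u′ t x (proj₁ r′)
    ... | q₁ , q₂ , L₁ , L₂ , related =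
      θ-trans (det p bs bound₁ steps₁ (Unique-⊑ (refl ∷ ++⁺ʳ _ ⊆-refl) unique) wEq L L₁)
        (θ-trans related
          (det u′ cs bound₂ steps₂ (Unique-⊑ (++⁺ˡ (inj₁ p ∷ bs) (_ ∷ʳ ⊆-refl)) unique)
            (trans (sym (lastOf-++ (inj₁ p) bs (inj₂ (a ∷ t)) (inj₁ u′ ∷ cs))) e) L₂ L′))
      where
      bound₁ : length bs ≤ N
      bound₁ = ≤-pred (≤-trans (s≤s (length-++-≤ˡ bs))
                 (≤-trans (≤-reflexive (sym (length-++-sucʳ bs (inj₂ (a ∷ t)) (inj₁ u′ ∷ cs)))) bound))
      bound₂ : length cs ≤ N
      bound₂ = ≤-pred (≤-trans (n≤1+n _) (≤-trans (length-++-≤ʳ (inj₂ (a ∷ t) ∷ inj₁ u′ ∷ cs) {bs}) bound))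

    -- Such a path closes up through the suffix vertex [ a ] into a compatible S-cycle.
    no-path-avoiding-a : ∀ {p p′ q q′} y ys → Linked AdjX (inj₁ p ∷ y ∷ ys) → Unique (inj₁ p ∷ y ∷ ys) →
                         lastOf y ys ≡ inj₁ p′ → Lit X p a q → Lit X p′ a q′ →
                         All (¬_ ∘ StartsWithᵃ) (y ∷ ys) → ⊥
    no-path-avoiding-a (inj₁ _) ys (() ∷ _) _ _ _ _ _
    no-path-avoiding-a {p} (inj₂ v₁) ys steps unique e L L′ noA =
      no-compatible-S-cycle p v₁ (ys ++ [ inj₂ [ a ] ]) (∷ʳ-nonempty ys _)
        (Linked-join (inj₁ p) (inj₂ v₁ ∷ ys) (inj₂ [ a ]) [] (Linked.map AdjX⇒AdjS steps)
          (subst (λ t → AdjS t (inj₂ [ a ])) (sym e) (Lit⇒S L′)) [-])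
        (subst (λ t → AdjS t (inj₁ p)) (sym (lastOf-++ (inj₂ v₁) ys (inj₂ [ a ]) [])) (Lit⇒S L))
        (Unique-∷ʳ unique ((λ ()) ∷ All.map (λ other e → other (subst StartsWithᵃ (sym e) refl)) noA))
        (PairwiseCompatible-∷ʳ (simple-path-compatible _ steps unique)
          (λ {w} i → suffix-[a]-compatible w (All.lookup ((λ ()) ∷ noA) i) (All.lookup (path-suffixes-nonempty steps) i)))

    deterministic : ∀ N → Deterministic N
    deterministic zero p [] _ _ _ refl L L′ = Lit-deterministic L L′
    deterministic zero p (_ ∷ _) () _ _ _ _ _
    deterministic (suc N) p l bound steps unique e L L′
      with First.first (swap ∘ toSum ∘ startsWithᵃ?) l
    ... | inj₁ firstA with toView firstA
    ...   | First._++_∷_ {bs} {v} _ startsA cs = split-at-suffix N (deterministic N) p bs v cs startsA bound steps unique e L L′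
    deterministic (suc N) p [] _ _ _ refl L L′ | inj₂ _ = Lit-deterministic L L′
    deterministic (suc N) p (y ∷ ys) _ steps unique e L L′ | inj₂ noA = ⊥-elim (no-path-avoiding-a y ys steps unique e L L′ noA)

    EndsWithᵃ : Vertex → Set
    EndsWithᵃ (inj₁ w) = ∃[ r ] (w ≡ r ++ [ a ])
    EndsWithᵃ (inj₂ _) = ⊥

    endsWithᵃ? : ∀ v → Dec (EndsWithᵃ v)
    endsWithᵃ? (inj₂ _) = no λ ()
    endsWithᵃ? (inj₁ w) with initLast w
    ... | [] = no λ { (r , e) → ∷ʳ-nonempty r a (sym e) }
    ... | r ∷ʳ′ c with c ≟ᶠ a
    ...   | yes refl = yes (r , refl)
    ...   | no c≢a = no λ { (r′ , e) → c≢a (∷ʳ-injectiveʳ r r′ e) }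

    prefix-[a]-compatible : ∀ w → ¬ EndsWithᵃ (inj₁ w) → w ≢ [] → Compatible (inj₁ [ a ]) (inj₁ w)
    prefix-[a]-compatible w other nonempty = (λ c e → ⊥-elim (other (c , e))) , shorter
      where
      shorter : NoProperSuffix w [ a ]
      shorter [] _ = refl
      shorter (d ∷ c) e = ⊥-elim (nonempty (++-conicalʳ c w (sym (∷-injectiveʳ e))))

    Reflecting : ℕ → Set
    Reflecting N = ∀ p l → length l ≤ N → Linked AdjX (inj₁ (p ++ [ a ]) ∷ l) → Unique (inj₁ (p ++ [ a ]) ∷ l) →
      ∀ {p′} → lastOf (inj₁ (p ++ [ a ])) l ≡ inj₁ (p′ ++ [ a ]) → Pref X p → Θ X p p′

    adjacent-prefix : ∀ r {y} → AdjX (inj₁ (r ++ [ a ])) y → Pref X r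
    adjacent-prefix r {inj₂ v} (x , _) = inj₂ (a , v , subst X (++-assoc r [ a ] v) x)

    -- A prefix vertex r a inside the path splits it into two shorter paths of the same kind.
    split-at-prefix : ∀ N → Reflecting N → ∀ p bs r cs p′ →
      let w = inj₁ (r ++ [ a ]) ; z = inj₁ (p′ ++ [ a ]) in
      length (bs ++ w ∷ cs ++ [ z ]) ≤ suc N → Linked AdjX (inj₁ (p ++ [ a ]) ∷ bs ++ w ∷ cs ++ [ z ]) →
      Unique (inj₁ (p ++ [ a ]) ∷ bs ++ w ∷ cs ++ [ z ]) → Pref X p → Θ X p p′
    split-at-prefix N reflect p bs r cs p′ bound steps unique pp
      with Linked-split (inj₁ (p ++ [ a ])) bs (inj₁ (r ++ [ a ])) _ steps
    ... | steps₁ , edge , steps₂ =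
      θ-trans
        (reflect p (bs ++ [ w ]) bound₁ (Linked-join _ bs w [] steps₁ edge [-])
          (Unique-⊑ (refl ∷ ++⁺ (⊆-refl {x = bs}) (refl ∷ []⊆-universal _)) unique) (lastOf-++ _ bs w []) pp)
        (reflect r (cs ++ [ z ]) bound₂ steps₂ (Unique-⊑ (++⁺ˡ (inj₁ (p ++ [ a ]) ∷ bs) ⊆-refl) unique)
          (lastOf-++ w cs z []) (r-prefix cs steps₂))
      where
      w z : Vertex
      w = inj₁ (r ++ [ a ])
      z = inj₁ (p′ ++ [ a ])
      r-prefix : ∀ cs → Linked AdjX (w ∷ cs ++ [ z ]) → Pref X r
      r-prefix [] (() ∷ _)
      r-prefix (y ∷ _) (e ∷ _) = adjacent-prefix r {y} e
      bound₁ : length (bs ++ [ w ]) ≤ N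
      bound₁ = ≤-pred (begin
        suc (length (bs ++ [ w ]))     ≡⟨ sym (length-∷ʳ (bs ++ [ w ]) z) ⟩
        length ((bs ++ [ w ]) ++ [ z ]) ≡⟨ cong length (++-assoc bs [ w ] [ z ]) ⟩
        length (bs ++ w ∷ [ z ])       ≤⟨ length-mono-≤ (++⁺ (⊆-refl {x = bs}) (refl ∷ ++⁺ˡ cs ⊆-refl)) ⟩
        length (bs ++ w ∷ cs ++ [ z ]) ≤⟨ bound ⟩
        suc N                          ∎)
        where open ≤-Reasoning
      bound₂ : length (cs ++ [ z ]) ≤ N
      bound₂ = ≤-pred (≤-trans (length-++-≤ʳ (w ∷ cs ++ [ z ]) {bs}) bound)

    -- Such a path closes up through the prefix vertex [ a ] into a compatible S-cycle, unless it
    -- has length two, p a and p′ a sharing their suffix vertex.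
    path-avoiding-a : ∀ p p′ l → Linked AdjX (inj₁ (p ++ [ a ]) ∷ l ++ [ inj₁ (p′ ++ [ a ]) ]) →
                      Unique (inj₁ (p ++ [ a ]) ∷ l ++ [ inj₁ (p′ ++ [ a ]) ]) → All (¬_ ∘ EndsWithᵃ) l → Θ X p p′
    path-avoiding-a p p′ [] (() ∷ _) _ _
    path-avoiding-a p p′ (inj₁ _ ∷ _) (() ∷ _) _ _
    path-avoiding-a p p′ (inj₂ v₁ ∷ []) ((x , _) ∷ (x′ , _) ∷ _) _ _ =
      θ-gen a v₁ (subst X (++-assoc p [ a ] v₁) x) (subst X (++-assoc p′ [ a ] v₁) x′)
    path-avoiding-a p p′ (inj₂ v₁ ∷ y ∷ ys) steps unique noA
      with Linked-split (inj₁ (p ++ [ a ])) (inj₂ v₁ ∷ y ∷ ys) (inj₁ (p′ ++ [ a ])) [] steps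
    ... | steps₁ , last , _ with suffix-neighbour {lastOf y ys} last
    ... | vₖ , lastEq , xₖ , _ = ⊥-elim (no-compatible-S-cycle [ a ] v₁ (y ∷ ys) (λ ())
          (S-drop-prefix p [ a ] v₁ (subst X (++-assoc p [ a ] v₁) (proj₁ (Linked.head steps₁)))
            ∷ Linked.tail (Linked.map AdjX⇒AdjS steps₁))
          (subst (λ t → AdjS t (inj₁ [ a ])) (sym lastEq) (S-drop-prefix p′ [ a ] vₖ (subst X (++-assoc p′ [ a ] vₖ) xₖ)))
          (All.map (λ other e → other (subst EndsWithᵃ e ([] , refl))) noA
            ∷ AllPairs.tail (Unique-⊑ (++⁺ʳ _ ⊆-refl) unique))
          (PairwiseCompatible-∷ (PairwiseCompatible-⊆ (there ∘ ∈-++⁺ˡ) compatible) with-[a]))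
      where
      compatible : PairwiseCompatible (inj₁ (p ++ [ a ]) ∷ (inj₂ v₁ ∷ y ∷ ys) ++ [ inj₁ (p′ ++ [ a ]) ])
      compatible = simple-path-compatible _ steps unique
      with-[a] : ∀ {t} → t ∈ inj₂ v₁ ∷ y ∷ ys → Compatible (inj₁ [ a ]) t
      with-[a] {inj₂ _} _ = tt
      with-[a] {inj₁ w} i = prefix-[a]-compatible w (All.lookup noA i) nonempty
        where
        nonempty : w ≢ []
        nonempty refl = ∷ʳ-nonempty p a
          (proj₁ (compatible (there (∈-++⁺ˡ i)) (here refl)) (p ++ [ a ]) (sym (++-identityʳ (p ++ [ a ]))))

    reflecting : ∀ N → Reflecting N
    reflecting zero p [] _ _ _ e pp = subst (Θ X p) (∷ʳ-injectiveˡ p _ (inj₁-injective e)) (θ-refl pp)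
    reflecting zero p (_ ∷ _) () _ _ _ _
    reflecting (suc N) p l bound steps unique e pp with initLast l
    ... | [] = subst (Θ X p) (∷ʳ-injectiveˡ p _ (inj₁-injective e)) (θ-refl pp)
    ... | l′ ∷ʳ′ z with trans (sym (lastOf-++ _ l′ z [])) e
    ...   | refl with First.first (swap ∘ toSum ∘ endsWithᵃ?) l′
    ...     | inj₁ firstA with toView firstA
    ...       | First._++_∷_ {bs} {inj₁ _} _ (r , refl) cs rewrite ++-assoc bs (inj₁ (r ++ [ a ]) ∷ cs) [ z ] =
                split-at-prefix N (reflecting N) p bs r cs _ bound steps unique pp
    reflecting (suc N) p .(l′ ++ [ z ]) _ steps unique {p′} _ _ | l′ ∷ʳ′ z | refl | inj₂ noA =
      path-avoiding-a p p′ l′ steps unique noA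

module _ {n : ℕ} {X : Lang n} where

  literal-path : ∀ p c s → Pref X p → X (p ++ c ∷ s) → CPath X p (c ∷ s) []
  literal-path p c [] pp x =
    cp-cons (p , [] , θ-refl pp , θ-refl (inj₁ refl) , pp , inj₂ (x , refl)) (cp-nil (θ-refl (inj₁ refl)))
  literal-path p c (d ∷ s) pp x =
    cp-cons (p , p ++ [ c ] , θ-refl pp , θ-refl pc , pp , inj₁ (pc , refl)) (literal-path (p ++ [ c ]) d s pc x′)
    where
    x′ : X ((p ++ [ c ]) ++ d ∷ s)
    x′ = subst X (sym (++-assoc p [ c ] (d ∷ s))) x
    pc : Pref X (p ++ [ c ])
    pc = inj₂ (d , s , x′)

module CosetAutomaton {n : ℕ} (S X : Lang n) (acyclic : Acyclic S) (bifix : BifixCode X)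
                      (X⊆S : ∀ x → X x → S x) where

  open CosetClasses S X acyclic bifix X⊆S

  Lit-injective : ∀ a {p p′ q q′} → Lit X p a q → Lit X p′ a q′ → Θ X q q′ → Θ X p p′
  Lit-injective a (_ , inj₂ (x , refl)) (_ , inj₂ (x′ , refl)) _ = θ-gen a [] x x′
  Lit-injective a {p′ = p′} (_ , inj₂ (_ , refl)) (_ , inj₁ (_ , refl)) t =
    ⊥-elim (∷ʳ-nonempty p′ a (proj₁ (Θ-empty t) refl))
  Lit-injective a {p} (_ , inj₁ (_ , refl)) (_ , inj₂ (_ , refl)) t =
    ⊥-elim (∷ʳ-nonempty p a (proj₂ (Θ-empty t) refl))
  Lit-injective a {p} (pp , inj₁ (_ , refl)) (_ , inj₁ (_ , refl)) t with Θ⇒SimplePath t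
  ... | l , steps , last , unique = reflecting a (length l) p l ≤-refl steps unique last pp

  Lit-deterministic-on-classes : ∀ a {p p′ q q′} → Θ X p p′ → Lit X p a q → Lit X p′ a q′ → Θ X q q′
  Lit-deterministic-on-classes a {p} t L L′ with Θ⇒SimplePath t
  ... | l , steps , last , unique = deterministic a (length l) p l ≤-refl steps unique last L L′

  reversible : CosetReversible X
  reversible a r r′ s s′ (p , q , r~p , s~q , L) (p′ , q′ , r′~p′ , s′~q′ , L′) = forward , backward
    where
    forward : Θ X r r′ → Θ X s s′
    forward r~r′ = θ-trans s~q (θ-trans
      (Lit-deterministic-on-classes a (θ-trans (θ-sym r~p) (θ-trans r~r′ r′~p′)) L L′) (θ-sym s′~q′))
    backward : Θ X s s′ → Θ X r r′
    backward s~s′ = θ-trans r~p (θ-trans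
      (Lit-injective a L L′ (θ-trans (θ-sym s~q) (θ-trans s~s′ s′~q′))) (θ-sym r′~p′))

  recognized : ∀ x → X x → Recognized X x
  recognized [] x = ⊥-elim (proj₁ bifix [] x refl)
  recognized (c ∷ s) x = literal-path [] c s (inj₁ refl) x

  private
    Pref-of-prefix : ∀ p w c t → X ((p ++ w) ++ c ∷ t) → Pref X p
    Pref-of-prefix p [] c t x = inj₂ (c , t , subst X (++-assoc p [] (c ∷ t)) x)
    Pref-of-prefix p (e ∷ w) c t x = inj₂ (e , w ++ c ∷ t , subst X (++-assoc p (e ∷ w) (c ∷ t)) x)

  -- Each step is forced by determinism of the coset automaton against the literal transition.
  path-follows-prefix : ∀ {r w s} → CPath X r w s → ∀ p c t → Θ X r p → X ((p ++ w) ++ c ∷ t) → Θ X s (p ++ w)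
  path-follows-prefix (cp-nil r~s) p c t r~p x =
    subst (Θ X _) (sym (++-identityʳ p)) (θ-trans (θ-sym r~s) r~p)
  path-follows-prefix {r} (cp-cons {a = a} {t = r′} {w = w} {s = s} step path) p c t r~p x =
    subst (Θ X s) (++-assoc p [ a ] w) (path-follows-prefix path (p ++ [ a ]) c t r′~pa x′)
    where
    x′ : X (((p ++ [ a ]) ++ w) ++ c ∷ t)
    x′ = subst (λ z → X (z ++ c ∷ t)) (sym (++-assoc p [ a ] w)) x
    pa-prefix : Pref X (p ++ [ a ])
    pa-prefix = Pref-of-prefix (p ++ [ a ]) w c t x′
    p-prefix : Pref X p
    p-prefix = Pref-of-prefix p (a ∷ w) c t x
    r′~pa : Θ X r′ (p ++ [ a ])
    r′~pa = proj₁ (reversible a r p r′ (p ++ [ a ]) step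
              (p , p ++ [ a ] , θ-refl p-prefix , θ-refl pa-prefix , p-prefix , inj₁ (pa-prefix , refl)))
            r~p

  minimal-generator : ∀ x → X x → MinGen (Recognized X) x
  minimal-generator x x∈X = recognized x x∈X , proj₁ bifix x x∈X , indecomposable
    where
    indecomposable : ¬ (∃[ u ] ∃[ v ] (Recognized X u × Recognized X v × u ≢ [] × v ≢ [] × x ≡ u ++ v))
    indecomposable (u , [] , _ , _ , _ , v≢[] , _) = v≢[] refl
    indecomposable (u , c ∷ t , u-rec , _ , u≢[] , _ , refl) =
      u≢[] (proj₁ (Θ-empty (path-follows-prefix u-rec [] c t (θ-refl (inj₁ refl)) x∈X)) refl)

-- The free group

module _ {n : ℕ} where

  private
    GL = GLetter {n}
    GW = GWord {n}

  inv-involutive : ∀ (x : GL) → inv (inv x) ≡ x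
  inv-involutive (inj₁ a) = refl
  inv-involutive (inj₂ a) = refl

  push-cancels : ∀ (x y : GL) w → y ≡ inv x → push x (y ∷ w) ≡ w
  push-cancels x y w e with ≡-dec⊎ _≟ᶠ_ _≟ᶠ_ y (inv x)
  ... | yes _ = refl
  ... | no ne = ⊥-elim (ne e)

  push-keeps : ∀ (x y : GL) w → y ≢ inv x → push x (y ∷ w) ≡ x ∷ y ∷ w
  push-keeps x y w ne with ≡-dec⊎ _≟ᶠ_ _≟ᶠ_ y (inv x)
  ... | yes e = ⊥-elim (ne e)
  ... | no _ = refl

  Reduced : GW → Set
  Reduced [] = ⊤
  Reduced (x ∷ []) = ⊤
  Reduced (x ∷ y ∷ w) = y ≢ inv x × Reduced (y ∷ w)

  Reduced-tail : ∀ {y : GL} {w} → Reduced (y ∷ w) → Reduced w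
  Reduced-tail {w = []} _ = tt
  Reduced-tail {w = _ ∷ _} (_ , r) = r

  push-reduced : ∀ x z → Reduced z → Reduced (push x z)
  push-reduced x [] _ = tt
  push-reduced x (y ∷ w) r with ≡-dec⊎ _≟ᶠ_ _≟ᶠ_ y (inv x)
  ... | yes _ = Reduced-tail r
  ... | no ne = ne , r

  reduce-reduced : ∀ w → Reduced (reduce w)
  reduce-reduced [] = tt
  reduce-reduced (x ∷ w) = push-reduced x (reduce w) (reduce-reduced w)

  push-inv-push : ∀ x z → Reduced z → push x (push (inv x) z) ≡ z
  push-inv-push x [] _ = push-cancels x (inv x) [] refl
  push-inv-push x (y ∷ w) r with ≡-dec⊎ _≟ᶠ_ _≟ᶠ_ y (inv (inv x))
  ... | no _ = push-cancels x (inv x) (y ∷ w) refl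
  push-inv-push x (y ∷ []) r | yes e = cong [_] (sym (trans e (inv-involutive x)))
  push-inv-push x (y ∷ y′ ∷ w) (ne , _) | yes e with trans e (inv-involutive x)
  ... | refl = push-keeps y y′ w ne

  pushAll : GW → GW → GW
  pushAll [] z = z
  pushAll (x ∷ u) z = push x (pushAll u z)

  reduce-++ : ∀ u v → reduce (u ++ v) ≡ pushAll u (reduce v)
  reduce-++ [] v = refl
  reduce-++ (x ∷ u) v = cong (push x) (reduce-++ u v)

  infix 4 _~_
  data _~_ : GW → GW → Set where
    ~-refl : ∀ {u} → u ~ u
    ~-sym : ∀ {u v} → u ~ v → v ~ u
    ~-trans : ∀ {u v w} → u ~ v → v ~ w → u ~ w
    ~-cancel : ∀ u x v → u ++ x ∷ inv x ∷ v ~ u ++ v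

  ≡⇒~ : ∀ {u v} → u ≡ v → u ~ v
  ≡⇒~ refl = ~-refl

  ~⇒reduce≡ : ∀ {u v} → u ~ v → reduce u ≡ reduce v
  ~⇒reduce≡ ~-refl = refl
  ~⇒reduce≡ (~-sym t) = sym (~⇒reduce≡ t)
  ~⇒reduce≡ (~-trans t t′) = trans (~⇒reduce≡ t) (~⇒reduce≡ t′)
  ~⇒reduce≡ (~-cancel u x v) = begin
    reduce (u ++ x ∷ inv x ∷ v)               ≡⟨ reduce-++ u (x ∷ inv x ∷ v) ⟩
    pushAll u (push x (push (inv x) (reduce v))) ≡⟨ cong (pushAll u) (push-inv-push x (reduce v) (reduce-reduced v)) ⟩
    pushAll u (reduce v)                      ≡⟨ sym (reduce-++ u v) ⟩
    reduce (u ++ v)                           ∎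
    where open ≡-Reasoning

  ~-++ʳ : ∀ {u u′} t → u ~ u′ → u ++ t ~ u′ ++ t
  ~-++ʳ t ~-refl = ~-refl
  ~-++ʳ t (~-sym p) = ~-sym (~-++ʳ t p)
  ~-++ʳ t (~-trans p q) = ~-trans (~-++ʳ t p) (~-++ʳ t q)
  ~-++ʳ t (~-cancel u x v) =
    subst₂ _~_ (sym (++-assoc u (x ∷ inv x ∷ v) t)) (sym (++-assoc u v t)) (~-cancel u x (v ++ t))

  ~-++ˡ : ∀ {u u′} t → u ~ u′ → t ++ u ~ t ++ u′
  ~-++ˡ t ~-refl = ~-refl
  ~-++ˡ t (~-sym p) = ~-sym (~-++ˡ t p)
  ~-++ˡ t (~-trans p q) = ~-trans (~-++ˡ t p) (~-++ˡ t q)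
  ~-++ˡ t (~-cancel u x v) =
    subst₂ _~_ (++-assoc t u (x ∷ inv x ∷ v)) (++-assoc t u v) (~-cancel (t ++ u) x v)

  invert : GW → GW
  invert w = reverse (map inv w)

  invert-++ : ∀ u v → invert (u ++ v) ≡ invert v ++ invert u
  invert-++ u v = trans (cong reverse (map-++ inv u v)) (reverse-++ (map inv u) (map inv v))

  invert-∷ : ∀ x w → invert (x ∷ w) ≡ invert w ++ [ inv x ]
  invert-∷ x w = unfold-reverse (inv x) (map inv w)

  invert-involutive : ∀ w → invert (invert w) ≡ w
  invert-involutive w = begin
    reverse (map inv (reverse (map inv w))) ≡⟨ cong reverse (reverse-map inv (map inv w)) ⟩
    reverse (reverse (map inv (map inv w))) ≡⟨ reverse-involutive (map inv (map inv w)) ⟩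
    map inv (map inv w)                     ≡⟨ map-inv-inv w ⟩
    w                                       ∎
    where
    open ≡-Reasoning
    map-inv-inv : ∀ w → map inv (map inv w) ≡ w
    map-inv-inv [] = refl
    map-inv-inv (x ∷ w) = cong₂ _∷_ (inv-involutive x) (map-inv-inv w)

  cancel-inverse : ∀ u w v → u ++ w ++ invert w ++ v ~ u ++ v
  cancel-inverse u [] v = ~-refl
  cancel-inverse u (x ∷ w) v =
    ~-trans (≡⇒~ regroup) (~-trans (cancel-inverse (u ++ [ x ]) w (inv x ∷ v))
      (~-trans (≡⇒~ (++-assoc u [ x ] (inv x ∷ v))) (~-cancel u x v)))
    where
    regroup : u ++ (x ∷ w) ++ invert (x ∷ w) ++ v ≡ (u ++ [ x ]) ++ w ++ invert w ++ inv x ∷ v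
    regroup = trans (cong (λ t → u ++ x ∷ w ++ t ++ v) (invert-∷ x w))
      (trans (cong (λ t → u ++ x ∷ w ++ t) (++-assoc (invert w) [ inv x ] v)) (sym (++-assoc u [ x ] _)))

  cancel-inverse′ : ∀ u w v → u ++ invert w ++ w ++ v ~ u ++ v
  cancel-inverse′ u w v =
    subst (λ t → u ++ invert w ++ t ++ v ~ u ++ v) (invert-involutive w) (cancel-inverse u (invert w) v)

  ~-invert : ∀ {u v} → u ~ v → invert u ~ invert v
  ~-invert ~-refl = ~-refl
  ~-invert (~-sym p) = ~-sym (~-invert p)
  ~-invert (~-trans p q) = ~-trans (~-invert p) (~-invert q)
  ~-invert (~-cancel u x v) =
    subst₂ _~_ (sym expand) (sym (invert-++ u v)) (~-cancel (invert v) (inv (inv x)) (invert u))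
    where
    expand : invert (u ++ x ∷ inv x ∷ v) ≡ invert v ++ inv (inv x) ∷ inv (inv (inv x)) ∷ invert u
    expand = begin
      invert (u ++ x ∷ inv x ∷ v)                       ≡⟨ invert-++ u (x ∷ inv x ∷ v) ⟩
      invert (x ∷ inv x ∷ v) ++ invert u                ≡⟨ cong (_++ invert u) (trans (invert-∷ x (inv x ∷ v))
                                                             (cong (_++ [ inv x ]) (invert-∷ (inv x) v))) ⟩
      ((invert v ++ [ inv (inv x) ]) ++ [ inv x ]) ++ invert u
        ≡⟨ trans (++-assoc (invert v ++ [ inv (inv x) ]) [ inv x ] (invert u)) (++-assoc (invert v) [ inv (inv x) ] _) ⟩
      invert v ++ inv (inv x) ∷ inv x ∷ invert u        ≡⟨ cong (λ t → invert v ++ inv (inv x) ∷ t ∷ invert u)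
                                                             (sym (inv-involutive (inv x))) ⟩
      invert v ++ inv (inv x) ∷ inv (inv (inv x)) ∷ invert u ∎
      where open ≡-Reasoning

  positive : Word n → GW
  positive = map inj₁

  concatMap-signed-++ : ∀ (l₁ l₂ : List (Bool × Word n)) →
                        concatMap signed (l₁ ++ l₂) ≡ concatMap signed l₁ ++ concatMap signed l₂
  concatMap-signed-++ [] l₂ = refl
  concatMap-signed-++ (p ∷ l₁) l₂ = trans (cong (signed p ++_) (concatMap-signed-++ l₁ l₂)) (sym (++-assoc (signed p) _ _))

  signed-false : ∀ x → signed (false , x) ≡ invert (positive x)
  signed-false x = cong reverse (sym (map-inv-positive x))
    where
    map-inv-positive : ∀ (x : Word n) → map inv (positive x) ≡ map inj₂ x
    map-inv-positive [] = refl
    map-inv-positive (c ∷ x) = cong (inj₂ c ∷_) (map-inv-positive x)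

  flip-sign : Bool × Word n → Bool × Word n
  flip-sign (b , x) = not b , x

  signed-flip : ∀ p → signed (flip-sign p) ≡ invert (signed p)
  signed-flip (true , x) = signed-false x
  signed-flip (false , x) = trans (sym (invert-involutive (positive x))) (cong invert (sym (signed-false x)))

  concatMap-signed-reverse : ∀ l → concatMap signed (reverse (map flip-sign l)) ≡ invert (concatMap signed l)
  concatMap-signed-reverse [] = refl
  concatMap-signed-reverse (p ∷ l) = begin
    concatMap signed (reverse (map flip-sign (p ∷ l)))
      ≡⟨ cong (concatMap signed) (unfold-reverse (flip-sign p) (map flip-sign l)) ⟩
    concatMap signed (reverse (map flip-sign l) ++ [ flip-sign p ])
      ≡⟨ concatMap-signed-++ (reverse (map flip-sign l)) [ flip-sign p ] ⟩
    concatMap signed (reverse (map flip-sign l)) ++ signed (flip-sign p) ++ []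
      ≡⟨ cong₂ _++_ (concatMap-signed-reverse l) (trans (++-identityʳ _) (signed-flip p)) ⟩
    invert (concatMap signed l) ++ invert (signed p)
      ≡⟨ sym (invert-++ (signed p) (concatMap signed l)) ⟩
    invert (concatMap signed (p ∷ l)) ∎
    where open ≡-Reasoning

module Subgroup {n : ℕ} (X : Lang n) where

  InSubgroup : GWord {n} → Set
  InSubgroup w = ∃[ l ] (All (λ bx → X (proj₂ bx)) l × concatMap signed l ~ w)

  InSubgroup-[] : InSubgroup []
  InSubgroup-[] = [] , [] , ~-refl

  InSubgroup-~ : ∀ {u v} → InSubgroup u → u ~ v → InSubgroup v
  InSubgroup-~ (l , gens , u~) t = l , gens , ~-trans u~ t

  InSubgroup-++ : ∀ {u v} → InSubgroup u → InSubgroup v → InSubgroup (u ++ v)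
  InSubgroup-++ {u} (l₁ , gens₁ , ~u) (l₂ , gens₂ , ~v) =
    l₁ ++ l₂ , All.++⁺ gens₁ gens₂ ,
    ~-trans (≡⇒~ (concatMap-signed-++ l₁ l₂)) (~-trans (~-++ʳ (concatMap signed l₂) ~u) (~-++ˡ u ~v))

  InSubgroup-invert : ∀ {u} → InSubgroup u → InSubgroup (invert u)
  InSubgroup-invert (l , gens , ~u) =
    reverse (map flip-sign l) , All-resp-↭ (↭-sym (↭-reverse _)) (All.map⁺ gens) ,
    ~-trans (≡⇒~ (concatMap-signed-reverse l)) (~-invert ~u)

  InSubgroup-generator : ∀ {x} → X x → InSubgroup (positive x)
  InSubgroup-generator {x} x∈X = (true , x) ∷ [] , x∈X ∷ [] , ≡⇒~ (++-identityʳ (positive x))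

  InSubgroup-chain : ∀ u w v → InSubgroup (u ++ invert w) → InSubgroup (w ++ v) → InSubgroup (u ++ v)
  InSubgroup-chain u w v h₁ h₂ =
    InSubgroup-~ (InSubgroup-++ h₁ h₂) (~-trans (≡⇒~ (++-assoc u (invert w) (w ++ v))) (cancel-inverse′ u w v))

  InSubgroup-self : ∀ w → InSubgroup (w ++ invert w)
  InSubgroup-self w =
    InSubgroup-~ InSubgroup-[] (~-sym (subst (_~ []) (cong (w ++_) (++-identityʳ (invert w))) (cancel-inverse [] w [])))

  private
    positive-++ : ∀ (p q : Word n) → positive (p ++ q) ≡ positive p ++ positive q
    positive-++ = map-++ inj₁

  Θ-in-subgroup : ∀ {p q} → Θ X p q → InSubgroup (positive p ++ invert (positive q))
  Θ-in-subgroup {p} (θ-refl _) = InSubgroup-self (positive p)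
  Θ-in-subgroup {p} {q} (θ-gen c s xp xq) =
    InSubgroup-~ (InSubgroup-++ (InSubgroup-generator xp) (InSubgroup-invert (InSubgroup-generator xq)))
      (~-trans (≡⇒~ regroup) (cancel-inverse (positive p) (positive (c ∷ s)) (invert (positive q))))
    where
    regroup : positive (p ++ c ∷ s) ++ invert (positive (q ++ c ∷ s))
            ≡ positive p ++ positive (c ∷ s) ++ invert (positive (c ∷ s)) ++ invert (positive q)
    regroup = trans (cong₂ _++_ (positive-++ p (c ∷ s))
                      (trans (cong invert (positive-++ q (c ∷ s))) (invert-++ (positive q) (positive (c ∷ s)))))
                    (++-assoc (positive p) (positive (c ∷ s)) _)
  Θ-in-subgroup {p} {q} (θ-sym t) =
    subst InSubgroup
      (trans (invert-++ (positive q) (invert (positive p))) (cong (_++ invert (positive q)) (invert-involutive (positive p))))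
      (InSubgroup-invert (Θ-in-subgroup t))
  Θ-in-subgroup {p} (θ-trans {q = m} {r = r} t t′) =
    InSubgroup-chain (positive p) (positive m) (invert (positive r)) (Θ-in-subgroup t) (Θ-in-subgroup t′)

  Lit-in-subgroup : ∀ {p a q} → Lit X p a q → InSubgroup (positive p ++ inj₁ a ∷ invert (positive q))
  Lit-in-subgroup {p} {a} (_ , inj₁ (_ , refl)) =
    subst InSubgroup (trans (cong (_++ invert (positive (p ++ [ a ]))) (positive-++ p [ a ])) (++-assoc (positive p) [ inj₁ a ] _))
      (InSubgroup-self (positive (p ++ [ a ])))
  Lit-in-subgroup {p} {a} (_ , inj₂ (x , refl)) = subst InSubgroup (positive-++ p [ a ]) (InSubgroup-generator x)

  CosetTrans-in-subgroup : ∀ {r a t} → CosetTrans X r a t → InSubgroup (positive r ++ inj₁ a ∷ invert (positive t))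
  CosetTrans-in-subgroup {r} {a} {t} (p , q , r~p , t~q , L) =
    subst InSubgroup (++-assoc (positive r) [ inj₁ a ] (invert (positive t)))
      (InSubgroup-chain (positive r ++ [ inj₁ a ]) (positive q) (invert (positive t))
        (subst InSubgroup (sym (++-assoc (positive r) [ inj₁ a ] (invert (positive q))))
          (InSubgroup-chain (positive r) (positive p) (inj₁ a ∷ invert (positive q)) (Θ-in-subgroup r~p) (Lit-in-subgroup L)))
        (Θ-in-subgroup (θ-sym t~q)))

  GPath-in-subgroup : ∀ {r w s} → GPath X r w s → InSubgroup (positive r ++ w ++ invert (positive s))
  GPath-in-subgroup (gp-nil r~s) = Θ-in-subgroup r~s
  GPath-in-subgroup {r} {inj₁ a ∷ w} {s} (gp-fwd {t = t} step path) =
    subst InSubgroup (++-assoc (positive r) [ inj₁ a ] (w ++ invert (positive s)))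
      (InSubgroup-chain (positive r ++ [ inj₁ a ]) (positive t) (w ++ invert (positive s))
        (subst InSubgroup (sym (++-assoc (positive r) [ inj₁ a ] (invert (positive t)))) (CosetTrans-in-subgroup step))
        (GPath-in-subgroup path))
  GPath-in-subgroup {r} {inj₂ a ∷ w} {s} (gp-bwd {t = t} step path) =
    subst InSubgroup (++-assoc (positive r) [ inj₂ a ] (w ++ invert (positive s)))
      (InSubgroup-chain (positive r ++ [ inj₂ a ]) (positive t) (w ++ invert (positive s))
        (subst InSubgroup backwards (InSubgroup-invert (CosetTrans-in-subgroup step)))
        (GPath-in-subgroup path))
    where
    backwards : invert (positive t ++ inj₁ a ∷ invert (positive r)) ≡ (positive r ++ [ inj₂ a ]) ++ invert (positive t)
    backwards = trans (invert-++ (positive t) (inj₁ a ∷ invert (positive r)))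
      (cong (_++ invert (positive t))
        (trans (invert-∷ (inj₁ a) (invert (positive r))) (cong (_++ [ inj₂ a ]) (invert-involutive (positive r)))))

  Θ-Pref : ∀ {p q} → Θ X p q → Pref X p × Pref X q
  Θ-Pref (θ-refl pp) = pp , pp
  Θ-Pref (θ-gen c s xp xq) = inj₂ (c , s , xp) , inj₂ (c , s , xq)
  Θ-Pref (θ-sym t) = Product.swap (Θ-Pref t)
  Θ-Pref (θ-trans t t′) = proj₁ (Θ-Pref t) , proj₂ (Θ-Pref t′)

  GPath-start : ∀ {r₀ r w s} → Θ X r₀ r → GPath X r w s → GPath X r₀ w s
  GPath-start r₀~r (gp-nil r~s) = gp-nil (θ-trans r₀~r r~s)
  GPath-start r₀~r (gp-fwd (p , q , r~p , t~q , L) path) = gp-fwd (p , q , θ-trans r₀~r r~p , t~q , L) path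
  GPath-start r₀~r (gp-bwd (p , q , t~p , r~q , L) path) = gp-bwd (p , q , t~p , θ-trans r₀~r r~q , L) path

  GPath-++ : ∀ {r w s w′ t} → GPath X r w s → GPath X s w′ t → GPath X r (w ++ w′) t
  GPath-++ (gp-nil r~s) path′ = GPath-start r~s path′
  GPath-++ (gp-fwd step path) path′ = gp-fwd step (GPath-++ path path′)
  GPath-++ (gp-bwd step path) path′ = gp-bwd step (GPath-++ path path′)

  GPath-invert : ∀ {r w s} → GPath X r w s → GPath X s (invert w) r
  GPath-invert (gp-nil r~s) = gp-nil (θ-sym r~s)
  GPath-invert {r} {inj₁ a ∷ w} (gp-fwd step@(_ , _ , r~p , _ , _) path) =
    subst (λ t → GPath X _ t r) (sym (invert-∷ (inj₁ a) w))
      (GPath-++ (GPath-invert path) (gp-bwd step (gp-nil (θ-refl (proj₁ (Θ-Pref r~p))))))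
  GPath-invert {r} {inj₂ a ∷ w} (gp-bwd step@(_ , _ , _ , r~q , _) path) =
    subst (λ t → GPath X _ t r) (sym (invert-∷ (inj₂ a) w))
      (GPath-++ (GPath-invert path) (gp-fwd step (gp-nil (θ-refl (proj₁ (Θ-Pref r~q))))))

  CPath⇒GPath : ∀ {r w s} → CPath X r w s → GPath X r (positive w) s
  CPath⇒GPath (cp-nil r~s) = gp-nil r~s
  CPath⇒GPath (cp-cons step path) = gp-fwd step (CPath⇒GPath path)

  generators-path : (∀ x → X x → x ≢ []) → ∀ l → All (λ bx → X (proj₂ bx)) l → GPath X [] (concatMap signed l) []
  generators-path nonempty [] [] = gp-nil (θ-refl (inj₁ refl))
  generators-path nonempty ((_ , []) ∷ l) (x ∷ _) = ⊥-elim (nonempty [] x refl)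
  generators-path nonempty ((true , c ∷ s) ∷ l) (x ∷ xs) =
    GPath-++ (CPath⇒GPath (literal-path [] c s (inj₁ refl) x)) (generators-path nonempty l xs)
  generators-path nonempty ((false , c ∷ s) ∷ l) (x ∷ xs) =
    GPath-++ (subst (λ t → GPath X [] t []) (sym (signed-false (c ∷ s)))
                (GPath-invert (CPath⇒GPath (literal-path [] c s (inj₁ refl) x))))
             (generators-path nonempty l xs)

  described⇔generated : (∀ x → X x → x ≢ []) → ∀ g → Described X g ⇔ Generated X g
  described⇔generated nonempty g = mk⇔ to from
    where
    to : Described X g → Generated X g
    to (w , path , refl) with GPath-in-subgroup path
    ... | l , gens , ~w = l , gens , trans (~⇒reduce≡ ~w) (cong reduce (++-identityʳ w))
    from : Generated X g → Described X g
    from (l , gens , e) = concatMap signed l , generators-path nonempty l gens , e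

proposition5p10 : ∀ {n : ℕ} (S X : Lang n) → Acyclic S → BifixCode X →
    (∀ x → X x → S x) →
    CosetReversible X
    × (∀ (g : GWord {n}) → Described X g ⇔ Generated X g)
    × (∀ x → X x → MinGen (Recognized X) x)
proposition5p10 S X acyclic bifix X⊆S =
  reversible , described⇔generated (proj₁ bifix) , minimal-generator
  where
  open CosetAutomaton S X acyclic bifix X⊆S using (reversible; minimal-generator)
  open Subgroup X using (described⇔generated)
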